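{- Let $k\ge 3$ and let $G$ be a mixed $k$-melon graph whose set of paths $\mathcal{P}=\mathcal{P}_{even}\cup\mathcal{P}_{odd}$ satisfies $|\mathcal{P}_{even}|=1$, say $\mathcal{P}_{even}=\{P_e\}$ with vertices $u_0=t,u_1,\dots,u_{2m}=s$ ($m\ge1$). For each odd path $P_o\in\mathcal{P}_{odd}$ write its vertices as $v_0=t,v_1,\dots,v_{2m_o+1}=s$. Define: (i) $U_s$ as the union of $\{s\}\cup\{u_{2j+1}:0\le j\le m-1\}$ and, for every $P_o\in\mathcal{P}_{odd}$, the set $\{v_{2i+1}:0\le i\le m_o\}$ (so $t\notin U_s$); (ii) $U_t$ as the union of $\{t\}\cup\{u_{2j+1}:0\le j\le m-1\}$ and, for every $P_o\in\mathcal{P}_{odd}$, the set $\{v_{2i}:0\le i\le m_o\}$ (so $s\notin U_t$); (iii) for $\mathcal{S}_o\subseteq\mathcal{P}_{odd}$, $U_{\mathcal{S}_o}$ as the vertex set such that $P_e$ is internal, every path of $\mathcal{S}_o$ is an $s$-path and every path of $\mathcal{P}_{odd}\setminus\mathcal{S}_o$ is a $t$-path, all with respect to $U_{\mathcal{S}_o}$. Then $\mathrm{evc}(G)=\mathrm{vc}(G)$, and $\mathcal{U}=\{U_s,U_t\}\cup\{U_{\mathcal{S}_o} : \emptyset\ne\mathcal{S}_o\subsetneq\mathcal{P}_{odd}\}$ is a minimum eternal vertex cover class of $G$.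
   Context: For $k\ge1$, a $k$-melon graph is the union of a set $\mathcal{P}$ of $k$ pairwise internally vertex-disjoint paths, each of length at least $1$, with the same two distinct endpoints $s$ and $t$. $\mathcal{P}_{even}$ and $\mathcal{P}_{odd}$ are the paths of even and odd length; $G$ is mixed if both are nonempty. For an even path $P$ with vertices $v_0,\dots,v_{2m}$, $\{v_0,v_{2m}\}=\{s,t\}$, and a vertex set $U$: $P$ is internal w.r.t. $U$ if $U\cap V(P)=\{v_{2j}:0\le j\le m\}$. For an odd path $P_o$ with vertices $v_0=t,\dots,v_{2m+1}=s$: $P_o$ is an $s$-path w.r.t. $U$ if $(U\cap V(P_o))\setminus\{t\}=\{v_{2i+1}:0\le i\le m\}$, a $t$-path if $(U\cap V(P_o))\setminus\{s\}=\{v_{2i}:0\le i\le m\}$. $\mathrm{vc}(G)$ is the vertex cover number. For a vertex cover $U$ of $G=(V,E)$ and an edge $e=vw$, a defense of $U$ against $e$ is a one-to-one map $\phi:U\to V$ with $\phi(u)\in N[u]$ (closed neighborhood) for all $u\in U$ and $\phi(v)=w$ (with $v\in U$) or $\phi(w)=v$ (with $w\in U$). An eternal vertex cover class is a family $\mathcal{U}$ of vertex covers of equal cardinality (its size) such that for every $U\in\mathcal{U}$ and every edge $e$ there is a defense $\phi$ of $U$ against $e$ with $\phi(U)\in\mathcal{U}$; $\mathrm{evc}(G)$ is the minimum size of such a class, and a class of that size is minimum. -}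

module Defs where

open import Data.Nat using (ℕ; zero; suc; _+_; _*_; _≤_)
open import Data.Fin using (Fin; toℕ; fromℕ; inject₁) renaming (suc to fsuc)
open import Data.Fin.Subset using (Subset; _∈_; _∉_; ∣_∣)
open import Data.Product using (Σ; ∃; ∃-syntax; _×_; _,_)
open import Data.Sum using (_⊎_)
open import Data.Empty using (⊥)
open import Relation.Nullary using (¬_)
open import Relation.Binary.PropositionalEquality using (_≡_; _≢_)
open import Function.Bundles using (_⇔_)
open import Level using (0ℓ) renaming (suc to lsuc)

Even : ℕ → Set
Even n = ∃[ q ] (n ≡ 2 * q)

Odd : ℕ → Set
Odd n = ∃[ q ] (n ≡ suc (2 * q))

record Graph : Set₁ where
  field
    N     : ℕ
    E     : Fin N → Fin N → Set
    sym   : ∀ {x y} → E x y → E y x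
    irrefl : ∀ {x} → ¬ E x x

module _ (G : Graph) where
  open Graph G

  IsVertexCover : Subset N → Set
  IsVertexCover U = ∀ x y → E x y → x ∈ U ⊎ y ∈ U

  IsVCNumber : ℕ → Set
  IsVCNumber n = (∃[ U ] (IsVertexCover U × ∣ U ∣ ≡ n))
               × (∀ U → IsVertexCover U → n ≤ ∣ U ∣)

  -- φ is a defense of U against the edge vw
  -- (φ : Fin N → Fin N, only its restriction to U matters)
  IsDefense : Subset N → Fin N → Fin N → (Fin N → Fin N) → Set
  IsDefense U v w φ =
      (∀ u → u ∈ U → φ u ≡ u ⊎ E u (φ u))
    × (∀ u u′ → u ∈ U → u′ ∈ U → φ u ≡ φ u′ → u ≡ u′)
    × ((v ∈ U × φ v ≡ w) ⊎ (w ∈ U × φ w ≡ v))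

  IsImage : (Fin N → Fin N) → Subset N → Subset N → Set
  IsImage φ U W = ∀ x → (x ∈ W) ⇔ (∃[ u ] (u ∈ U × φ u ≡ x))

  IsEVCClass : (Subset N → Set) → ℕ → Set
  IsEVCClass 𝒰 c =
      (∃[ U ] 𝒰 U)
    × (∀ U → 𝒰 U → IsVertexCover U × ∣ U ∣ ≡ c)
    × (∀ U → 𝒰 U → ∀ v w → E v w →
         ∃[ φ ] (IsDefense U v w φ × ∃[ W ] (𝒰 W × IsImage φ U W)))

  IsEVCNumber : ℕ → Set₁
  IsEVCNumber n = (∃[ 𝒰 ] IsEVCClass 𝒰 n)
                × (∀ 𝒰 c → IsEVCClass 𝒰 c → n ≤ c)

  IsMinimumEVCClass : (Subset N → Set) → Set₁
  IsMinimumEVCClass 𝒰 = ∃[ n ] (IsEVCClass 𝒰 n × IsEVCNumber n)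

record Melon (G : Graph) (k : ℕ) : Set where
  open Graph G
  field
    s t      : Fin N
    s≢t      : s ≢ t
    L        : Fin k → ℕ
    L≥1      : ∀ i → 1 ≤ L i
    p        : (i : Fin k) → Fin (suc (L i)) → Fin N
    start    : ∀ i → p i Data.Fin.zero ≡ t
    end      : ∀ i → p i (fromℕ (L i)) ≡ s
    path-inj : ∀ i j j′ → p i j ≡ p i j′ → j ≡ j′
    path-adj : ∀ i (j : Fin (L i)) → E (p i (inject₁ j)) (p i (fsuc j))
    int-disj : ∀ i i′ j j′ → p i j ≡ p i′ j′ → i ≡ i′ ⊎ (p i j ≡ s ⊎ p i j ≡ t)
    -- the k paths are pairwise distinct (only possible coincidence: two copies of the edge st)
    distinct : ∀ i i′ → L i ≡ 1 → L i′ ≡ 1 → i ≡ i′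
    cover-V  : ∀ x → ∃[ i ] ∃[ j ] (p i j ≡ x)
    cover-E  : ∀ x y → E x y → ∃[ i ] ∃[ j ]
                 ((p i (inject₁ j) ≡ x × p i (fsuc j) ≡ y)
                  ⊎ (p i (inject₁ j) ≡ y × p i (fsuc j) ≡ x))

module _ {G : Graph} {k : ℕ} (M : Melon G k) where
  open Graph G
  open Melon M

  OnPath : Fin k → Fin N → Set
  OnPath i x = ∃[ j ] (p i j ≡ x)

  EvenPos OddPos : Fin k → Fin N → Set
  EvenPos i x = ∃[ j ] (p i j ≡ x × Even (toℕ j))
  OddPos  i x = ∃[ j ] (p i j ≡ x × Odd (toℕ j))

  IsInternal : Fin k → Subset N → Set
  IsInternal i U = ∀ x → (x ∈ U × OnPath i x) ⇔ EvenPos i x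

  IsSPath : Fin k → Subset N → Set
  IsSPath i U = ∀ x → (x ∈ U × OnPath i x × x ≢ t) ⇔ OddPos i x

  IsTPath : Fin k → Subset N → Set
  IsTPath i U = ∀ x → (x ∈ U × OnPath i x × x ≢ s) ⇔ EvenPos i x

  -- the family 𝒰 of the theorem, where e is the index of the unique even path
  module _ (e : Fin k) where
    InUs : Fin N → Set
    InUs x = x ≡ s ⊎ OddPos e x ⊎ ∃[ o ] (o ≢ e × OddPos o x)

    InUt : Fin N → Set
    InUt x = x ≡ t ⊎ OddPos e x ⊎ ∃[ o ] (o ≢ e × EvenPos o x)

    IsUS : Subset k → Subset N → Set
    IsUS S U = IsInternal e U
             × (∀ o → o ≢ e → o ∈ S → IsSPath o U)
             × (∀ o → o ≢ e → o ∉ S → IsTPath o U)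

    NonemptyProperOdd : Subset k → Set
    NonemptyProperOdd S = (∀ o → o ∈ S → o ≢ e)
                        × (∃[ o ] (o ∈ S))
                        × (∃[ o ] (o ≢ e × o ∉ S))

    𝒰fam : Subset N → Set
    𝒰fam U = (∀ x → (x ∈ U) ⇔ InUs x)
           ⊎ (∀ x → (x ∈ U) ⇔ InUt x)
           ⊎ (∃[ S ] (NonemptyProperOdd S × IsUS S U))

module Submission where

-- A member of 𝒰 is described by whether it contains s and t and, on each path, by the
-- parity of the interior positions it occupies. An edge is defended by a move that shifts all
-- vertices of some paths one step along their path and may pass s or t on to a neighbouring path.
-- Every move used has an inverse move, so it maps its set bijectively onto another member of 𝒰;
-- hence 𝒰 is an eternal vertex cover class and all its members have the size of U_s. Conversely,
-- given a vertex cover C, one of U_s, U_t or some U_S (chosen by whether s, t ∈ C) can be traded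
-- injectively into C: each of its vertices outside C is sent one step along its path to a vertex
-- of C outside the set. So |U_s| ≤ vc(G) ≤ evc(G) ≤ |U_s|.

open import Defs
open import Data.Bool using (Bool; true; false; not; if_then_else_)
open import Data.Bool.Properties using (not-injective; not-involutive)
open import Data.Empty using (⊥; ⊥-elim)
open import Data.Fin as Fin using (Fin; toℕ; fromℕ; fromℕ<; inject₁) renaming (suc to fsuc)
import Data.Fin.Properties as Fin
open import Data.Fin.Subset using (Subset; _∈_; _∉_; _⊆_; ∣_∣; _-_; inside; outside; Nonempty)
open import Data.Fin.Subset.Properties
  using (_∈?_; ⊆-antisym; nonempty?; Empty-unique; ∣⊥∣≡0; x∈p∧x≢y⇒x∈p-y; p─q⊆p; p─⊥≡p)
open import Data.Maybe using (Maybe; just; nothing)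
open import Data.Nat as ℕ using (ℕ; zero; suc; pred; _+_; _*_; _≤_; _<_; z≤n; s≤s)
import Data.Nat.Properties as ℕ
open import Data.Product using (∃-syntax; _×_; _,_; proj₁; proj₂; uncurry)
open import Data.Sum using (_⊎_; inj₁; inj₂)
open import Data.Unit using (⊤; tt)
open import Data.Vec using (_∷_; here; there; tabulate)
import Data.Vec.Properties as Vec
open import Function using (_∘_)
open import Function.Bundles using (_⇔_; mk⇔; Equivalence)
open import Relation.Nullary using (¬_; yes; no; does; contradiction)
open import Relation.Binary.PropositionalEquality

open Equivalence using (to; from)

∣p∣≡1+∣p-x∣ : ∀ {n} {p : Subset n} {x} → x ∈ p → ∣ p ∣ ≡ suc ∣ p - x ∣
∣p∣≡1+∣p-x∣ {p = inside ∷ p} here = cong suc (sym (cong ∣_∣ (p─⊥≡p p)))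
∣p∣≡1+∣p-x∣ {p = inside ∷ p} (there x∈p) = cong suc (∣p∣≡1+∣p-x∣ x∈p)
∣p∣≡1+∣p-x∣ {p = outside ∷ p} (there x∈p) = ∣p∣≡1+∣p-x∣ x∈p

x∉p-x : ∀ {n} (p : Subset n) x → x ∉ p - x
x∉p-x (inside ∷ p) Fin.zero ()
x∉p-x (outside ∷ p) Fin.zero ()
x∉p-x (_ ∷ p) (fsuc x) (there x∈p-x) = x∉p-x p x x∈p-x

∣p∣≡1+c⇒Nonempty : ∀ {n c} (p : Subset n) → ∣ p ∣ ≡ suc c → Nonempty p
∣p∣≡1+c⇒Nonempty {n} p ∣p∣≡1+c with nonempty? p
... | yes p≢∅ = p≢∅
... | no p≡∅ = contradiction (trans (sym (∣⊥∣≡0 n)) (trans (cong ∣_∣ (sym (Empty-unique p≡∅))) ∣p∣≡1+c)) λ ()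

injection⇒∣p∣≤∣q∣ : ∀ {n} {p q : Subset n} (f : Fin n → Fin n) → (∀ {x} → x ∈ p → f x ∈ q) →
                    (∀ {x y} → x ∈ p → y ∈ p → f x ≡ f y → x ≡ y) → ∣ p ∣ ≤ ∣ q ∣
injection⇒∣p∣≤∣q∣ {n} {p} f = go ∣ p ∣ refl
  where
  go : ∀ c {p q : Subset n} → ∣ p ∣ ≡ c → (∀ {x} → x ∈ p → f x ∈ q) →
       (∀ {x y} → x ∈ p → y ∈ p → f x ≡ f y → x ≡ y) → ∣ p ∣ ≤ ∣ q ∣
  go zero ∣p∣≡0 _ _ = subst (_≤ _) (sym ∣p∣≡0) z≤n
  go (suc c) {p} {q} ∣p∣≡1+c into inj with ∣p∣≡1+c⇒Nonempty p ∣p∣≡1+c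
  ... | x , x∈p = subst₂ _≤_ (sym (∣p∣≡1+∣p-x∣ x∈p)) (sym (∣p∣≡1+∣p-x∣ (into x∈p)))
                         (s≤s (go c ∣p-x∣≡c into′ inj′))
    where
    ∣p-x∣≡c : ∣ p - x ∣ ≡ c
    ∣p-x∣≡c = ℕ.suc-injective (trans (sym (∣p∣≡1+∣p-x∣ x∈p)) ∣p∣≡1+c)
    ∈p : ∀ {y} → y ∈ p - x → y ∈ p
    ∈p = p─q⊆p _ _
    into′ : ∀ {y} → y ∈ p - x → f y ∈ q - f x
    into′ {y} y∈p-x = x∈p∧x≢y⇒x∈p-y (into (∈p y∈p-x))
      λ fy≡fx → x∉p-x p x (subst (_∈ p - x) (inj (∈p y∈p-x) x∈p fy≡fx) y∈p-x)
    inj′ : ∀ {y z} → y ∈ p - x → z ∈ p - x → f y ≡ f z → y ≡ z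
    inj′ y∈ z∈ = inj (∈p y∈) (∈p z∈)

exchange⇒∣p∣≤∣q∣ : ∀ {n} {p q : Subset n} (g : Fin n → Fin n) →
  (∀ {x} → x ∈ p → x ∉ q → g x ∈ q × g x ∉ p) →
  (∀ {x y} → x ∈ p → x ∉ q → y ∈ p → y ∉ q → g x ≡ g y → x ≡ y) → ∣ p ∣ ≤ ∣ q ∣
exchange⇒∣p∣≤∣q∣ {n} {p} {q} g trade g-inj = injection⇒∣p∣≤∣q∣ f into inj
  where
  f : Fin n → Fin n
  f x with x ∈? q
  ... | yes _ = x
  ... | no _ = g x
  into : ∀ {x} → x ∈ p → f x ∈ q
  into {x} x∈p with x ∈? q
  ... | yes x∈q = x∈q
  ... | no x∉q = proj₁ (trade x∈p x∉q)
  inj : ∀ {x y} → x ∈ p → y ∈ p → f x ≡ f y → x ≡ y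
  inj {x} {y} x∈p y∈p fx≡fy with x ∈? q | y ∈? q
  ... | yes _ | yes _ = fx≡fy
  ... | yes _ | no y∉q = contradiction (subst (_∈ p) fx≡fy x∈p) (proj₂ (trade y∈p y∉q))
  ... | no x∉q | yes _ = contradiction (subst (_∈ p) (sym fx≡fy) y∈p) (proj₂ (trade x∈p x∉q))
  ... | no x∉q | no y∉q = g-inj x∈p x∉q y∈p y∉q fx≡fy

∈tabulate⁻ : ∀ {n} (f : Fin n → Bool) {x} → x ∈ tabulate f → f x ≡ true
∈tabulate⁻ f {x} x∈ = trans (sym (Vec.lookup∘tabulate f x)) (Vec.[]=⇒lookup x∈)

∈tabulate⁺ : ∀ {n} (f : Fin n → Bool) {x} → f x ≡ true → x ∈ tabulate f
∈tabulate⁺ f {x} fx = Vec.lookup⇒[]= x (tabulate f) (trans (Vec.lookup∘tabulate f x) fx)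

∃-≢₂ : ∀ {k} → 3 ≤ k → (a b : Fin k) → ∃[ c ] (c ≢ a × c ≢ b)
∃-≢₂ (s≤s (s≤s (s≤s _))) Fin.zero Fin.zero = fsuc Fin.zero , (λ ()) , (λ ())
∃-≢₂ (s≤s (s≤s (s≤s _))) Fin.zero (fsuc Fin.zero) = fsuc (fsuc Fin.zero) , (λ ()) , (λ ())
∃-≢₂ (s≤s (s≤s (s≤s _))) Fin.zero (fsuc (fsuc b)) = fsuc Fin.zero , (λ ()) , (λ ())
∃-≢₂ (s≤s (s≤s (s≤s _))) (fsuc Fin.zero) Fin.zero = fsuc (fsuc Fin.zero) , (λ ()) , (λ ())
∃-≢₂ (s≤s (s≤s (s≤s _))) (fsuc (fsuc a)) Fin.zero = fsuc Fin.zero , (λ ()) , (λ ())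
∃-≢₂ (s≤s (s≤s (s≤s _))) (fsuc a) (fsuc b) = Fin.zero , (λ ()) , (λ ())

0<n<l⇒2≤l : ∀ {n l} → 0 < n → n < l → 2 ≤ l
0<n<l⇒2≤l (s≤s z≤n) (s≤s (s≤s _)) = s≤s (s≤s z≤n)

0<pred : ∀ {l} → 2 ≤ l → 0 < pred l
0<pred (s≤s (s≤s _)) = s≤s z≤n

pred< : ∀ {l} → 2 ≤ l → pred l < l
pred< (s≤s (s≤s _)) = ℕ.≤-refl

-- Boolean-valued, so that odd (suc n) = not (odd n) holds by computation.
odd : ℕ → Bool
odd zero = false
odd (suc n) = not (odd n)

odd-2* : ∀ q → odd (2 * q) ≡ false
odd-2* zero = refl
odd-2* (suc q) rewrite ℕ.+-suc q (q + 0) = cong (λ b → not (not b)) (odd-2* q)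

Even⇒odd≡false : ∀ {n} → Even n → odd n ≡ false
Even⇒odd≡false (q , refl) = odd-2* q

Odd⇒odd≡true : ∀ {n} → Odd n → odd n ≡ true
Odd⇒odd≡true (q , refl) = cong not (odd-2* q)

odd≡false⇒Even : ∀ n → odd n ≡ false → Even n
odd≡true⇒Odd : ∀ n → odd n ≡ true → Odd n
odd≡false⇒Even zero _ = 0 , refl
odd≡false⇒Even (suc n) eq with odd≡true⇒Odd n (not-injective eq)
... | q , refl = suc q , cong suc (sym (ℕ.+-suc q (q + 0)))
odd≡true⇒Odd zero ()
odd≡true⇒Odd (suc n) eq with odd≡false⇒Even n (not-injective eq)
... | q , refl = q , refl

¬Even∧Odd : ∀ {n} → Even n → Odd n → ⊥
¬Even∧Odd (m , refl) (n , eq) = ℕ.even≢odd m n eq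

¬Odd0 : ¬ Odd 0
¬Odd0 (_ , ())

agree : Bool → Bool → Bool
agree true b = b
agree false b = not b

agree-refl : ∀ b → agree b b ≡ true
agree-refl true = refl
agree-refl false = refl

agree⇒≡ : ∀ a b → agree a b ≡ true → a ≡ b
agree⇒≡ true true _ = refl
agree⇒≡ false false _ = refl

agree-≡ : ∀ {a b c} → a ≡ c → b ≡ c → agree a b ≡ true
agree-≡ {c = c} refl refl = agree-refl c

agree-not : ∀ b → agree b (not b) ≡ false
agree-not true = refl
agree-not false = refl

agree-not′ : ∀ b → agree (not b) b ≡ false
agree-not′ true = refl
agree-not′ false = refl

evc-class-at-cover-bound : ∀ G {𝒰 n} → IsEVCClass G 𝒰 n → (∀ C → IsVertexCover G C → n ≤ ∣ C ∣) →
                           IsVCNumber G n × IsEVCNumber G n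
evc-class-at-cover-bound G {𝒰} {n} class@((U , U∈) , covers , _) bound =
  ((U , covers U U∈) , bound) , ((𝒰 , class) , λ { _ _ ((V , V∈) , covers′ , _) → size-bound (covers′ V V∈) })
  where
  size-bound : ∀ {V c} → IsVertexCover G V × ∣ V ∣ ≡ c → n ≤ c
  size-bound {V} (cover , refl) = bound V cover

-- Positions on the paths of a melon

module Coordinates {G : Graph} {k : ℕ} (M : Melon G k) where
  open Graph G using (N; E) renaming (sym to E-sym)
  open Melon M

  -- (i , n) is the n-th vertex of path i, counted from t.
  Pos : Set
  Pos = Fin k × ℕ

  -- Positions beyond the end of a path are sent to s; they never occur.
  vertexAt : Fin k → ℕ → Fin N
  vertexAt i n with n ℕ.≤? L i
  ... | yes n≤L = p i (fromℕ< (s≤s n≤L))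
  ... | no _ = s

  vertexAt-toℕ : ∀ i (j : Fin (suc (L i))) → vertexAt i (toℕ j) ≡ p i j
  vertexAt-toℕ i j with toℕ j ℕ.≤? L i
  ... | yes j≤L = cong (p i) (Fin.fromℕ<-toℕ j (s≤s j≤L))
  ... | no j≰L = contradiction (Fin.toℕ≤pred[n] j) j≰L

  vertexAt-fromℕ< : ∀ i {n} (n≤L : n ≤ L i) → vertexAt i n ≡ p i (fromℕ< (s≤s n≤L))
  vertexAt-fromℕ< i n≤L =
    trans (cong (vertexAt i) (sym (Fin.toℕ-fromℕ< (s≤s n≤L)))) (vertexAt-toℕ i _)

  vertexAt-0 : ∀ i → vertexAt i 0 ≡ t
  vertexAt-0 i = trans (vertexAt-toℕ i Fin.zero) (start i)

  vertexAt-L : ∀ i → vertexAt i (L i) ≡ s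
  vertexAt-L i = trans (cong (vertexAt i) (sym (Fin.toℕ-fromℕ (L i))))
                       (trans (vertexAt-toℕ i (fromℕ (L i))) (end i))

  vertexAt-adj : ∀ i {n} → n < L i → E (vertexAt i n) (vertexAt i (suc n))
  vertexAt-adj i {n} n<L = subst₂ E lower upper (path-adj i j)
    where
    j : Fin (L i)
    j = fromℕ< n<L
    lower : p i (inject₁ j) ≡ vertexAt i n
    lower = trans (sym (vertexAt-toℕ i (inject₁ j)))
                  (cong (vertexAt i) (trans (Fin.toℕ-inject₁ j) (Fin.toℕ-fromℕ< n<L)))
    upper : p i (fsuc j) ≡ vertexAt i (suc n)
    upper = trans (sym (vertexAt-toℕ i (fsuc j)))
                  (cong (λ m → vertexAt i (suc m)) (Fin.toℕ-fromℕ< n<L))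

  infix 4 _≈ₚ_
  _≈ₚ_ : Pos → Pos → Set
  (i , n) ≈ₚ (i′ , n′) = (i ≡ i′ × n ≡ n′) ⊎ (n ≡ L i × n′ ≡ L i′) ⊎ (n ≡ 0 × n′ ≡ 0)

  ≈ₚ-refl : ∀ {a} → a ≈ₚ a
  ≈ₚ-refl = inj₁ (refl , refl)

  ≈ₚ⇒vertexAt≡ : ∀ {i n i′ n′} → (i , n) ≈ₚ (i′ , n′) → vertexAt i n ≡ vertexAt i′ n′
  ≈ₚ⇒vertexAt≡ (inj₁ (refl , refl)) = refl
  ≈ₚ⇒vertexAt≡ {i} {i′ = i′} (inj₂ (inj₁ (refl , refl))) =
    trans (vertexAt-L i) (sym (vertexAt-L i′))
  ≈ₚ⇒vertexAt≡ {i} {i′ = i′} (inj₂ (inj₂ (refl , refl))) =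
    trans (vertexAt-0 i) (sym (vertexAt-0 i′))

  p≡s⇒toℕ≡L : ∀ i (j : Fin (suc (L i))) → p i j ≡ s → toℕ j ≡ L i
  p≡s⇒toℕ≡L i j eq =
    trans (cong toℕ (path-inj i j (fromℕ (L i)) (trans eq (sym (end i))))) (Fin.toℕ-fromℕ (L i))

  p≡t⇒toℕ≡0 : ∀ i (j : Fin (suc (L i))) → p i j ≡ t → toℕ j ≡ 0
  p≡t⇒toℕ≡0 i j eq = cong toℕ (path-inj i j Fin.zero (trans eq (sym (start i))))

  p≡⇒≈ₚ : ∀ i j i′ j′ → p i j ≡ p i′ j′ → (i , toℕ j) ≈ₚ (i′ , toℕ j′)
  p≡⇒≈ₚ i j i′ j′ eq with int-disj i i′ j j′ eq
  ... | inj₁ refl = inj₁ (refl , cong toℕ (path-inj i j j′ eq))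
  ... | inj₂ (inj₁ ≡s) = inj₂ (inj₁ (p≡s⇒toℕ≡L i j ≡s , p≡s⇒toℕ≡L i′ j′ (trans (sym eq) ≡s)))
  ... | inj₂ (inj₂ ≡t) = inj₂ (inj₂ (p≡t⇒toℕ≡0 i j ≡t , p≡t⇒toℕ≡0 i′ j′ (trans (sym eq) ≡t)))

  vertexAt≡⇒≈ₚ : ∀ {i n i′ n′} → n ≤ L i → n′ ≤ L i′ →
                 vertexAt i n ≡ vertexAt i′ n′ → (i , n) ≈ₚ (i′ , n′)
  vertexAt≡⇒≈ₚ {i} {n} {i′} {n′} n≤L n′≤L eq =
    subst₂ (λ a b → (i , a) ≈ₚ (i′ , b)) (Fin.toℕ-fromℕ< (s≤s n≤L)) (Fin.toℕ-fromℕ< (s≤s n′≤L))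
      (p≡⇒≈ₚ i _ i′ _ (trans (sym (vertexAt-fromℕ< i n≤L)) (trans eq (vertexAt-fromℕ< i′ n′≤L))))

  position : Fin N → Pos
  position x = let (i , j , _) = cover-V x in i , toℕ j

  position-≤ : ∀ x → proj₂ (position x) ≤ L (proj₁ (position x))
  position-≤ x = let (_ , j , _) = cover-V x in Fin.toℕ≤pred[n] j

  vertexAt-position : ∀ x → uncurry vertexAt (position x) ≡ x
  vertexAt-position x = let (i , j , eq) = cover-V x in trans (vertexAt-toℕ i j) eq

  position-vertexAt : ∀ i {n} → n ≤ L i → position (vertexAt i n) ≈ₚ (i , n)
  position-vertexAt i {n} n≤L =
    vertexAt≡⇒≈ₚ (position-≤ (vertexAt i n)) n≤L (vertexAt-position (vertexAt i n))

  vertexAt-OddPos : ∀ i {n} → n ≤ L i → Odd n → OddPos M i (vertexAt i n)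
  vertexAt-OddPos i n≤L od =
    fromℕ< (s≤s n≤L) , sym (vertexAt-fromℕ< i n≤L) , subst Odd (sym (Fin.toℕ-fromℕ< (s≤s n≤L))) od

  vertexAt-EvenPos : ∀ i {n} → n ≤ L i → Even n → EvenPos M i (vertexAt i n)
  vertexAt-EvenPos i n≤L ev =
    fromℕ< (s≤s n≤L) , sym (vertexAt-fromℕ< i n≤L) , subst Even (sym (Fin.toℕ-fromℕ< (s≤s n≤L))) ev

  p≢t⇒0<toℕ : ∀ i (j : Fin (suc (L i))) → p i j ≢ t → 0 < toℕ j
  p≢t⇒0<toℕ i j pj≢t with toℕ j in j≡0
  ... | zero = contradiction (trans (sym (vertexAt-toℕ i j)) (trans (cong (vertexAt i) j≡0) (vertexAt-0 i)))
                             pj≢t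
  ... | suc _ = s≤s z≤n

  p≢s⇒toℕ<L : ∀ i (j : Fin (suc (L i))) → p i j ≢ s → toℕ j < L i
  p≢s⇒toℕ<L i j pj≢s = ℕ.≤∧≢⇒< (Fin.toℕ≤pred[n] j) λ j≡L →
    pj≢s (trans (sym (vertexAt-toℕ i j)) (trans (cong (vertexAt i) j≡L) (vertexAt-L i)))

  EdgeAt : Fin N → Fin N → Fin k → ℕ → Set
  EdgeAt v w i n = (vertexAt i n ≡ v × vertexAt i (suc n) ≡ w)
                 ⊎ (vertexAt i n ≡ w × vertexAt i (suc n) ≡ v)

  edge-position : ∀ v w → E v w → ∃[ i ] ∃[ n ] (n < L i × EdgeAt v w i n)
  edge-position v w vw with cover-E v w vw
  ... | i , j , orientation = i , toℕ j , Fin.toℕ<n j , along orientation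
    where
    lower : vertexAt i (toℕ j) ≡ p i (inject₁ j)
    lower = trans (cong (vertexAt i) (sym (Fin.toℕ-inject₁ j))) (vertexAt-toℕ i (inject₁ j))
    along : (p i (inject₁ j) ≡ v × p i (fsuc j) ≡ w) ⊎ (p i (inject₁ j) ≡ w × p i (fsuc j) ≡ v) →
            EdgeAt v w i (toℕ j)
    along (inj₁ (a , b)) = inj₁ (trans lower a , trans (vertexAt-toℕ i (fsuc j)) b)
    along (inj₂ (a , b)) = inj₂ (trans lower a , trans (vertexAt-toℕ i (fsuc j)) b)

-- Configurations and moves

module Configurations {G : Graph} {k : ℕ} (M : Melon G k) where
  open Graph G using (N; E) renaming (sym to E-sym)
  open Melon M
  open Coordinates M

  L≢0 : ∀ i → L i ≢ 0
  L≢0 i L≡0 = contradiction (subst (1 ≤_) L≡0 (L≥1 i)) λ ()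

  L≡1⊎2≤L : ∀ i → L i ≡ 1 ⊎ 2 ≤ L i
  L≡1⊎2≤L i with L i | L≢0 i
  ... | zero | L≢0 = contradiction refl L≢0
  ... | suc zero | _ = inj₁ refl
  ... | suc (suc _) | _ = inj₂ (s≤s (s≤s z≤n))

  -- A vertex set containing s and t according to s∈ and t∈, and the interior vertices of path i
  -- at odd positions if oddIn i, at even positions otherwise.
  record Config : Set where
    constructor config
    field
      s∈ t∈ : Bool
      oddIn : Fin k → Bool
  open Config public

  occupied : Config → Fin k → ℕ → Bool
  occupied c i zero = t∈ c
  occupied c i (suc n) with suc n ℕ.≟ L i
  ... | yes _ = s∈ c
  ... | no _ = agree (oddIn c i) (odd (suc n))

  data Dir : Set where
    towardS towardT stay : Dir

  flip : Dir → Dir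
  flip towardS = towardT
  flip towardT = towardS
  flip stay = stay

  flip-involutive : ∀ d → flip (flip d) ≡ d
  flip-involutive towardS = refl
  flip-involutive towardT = refl
  flip-involutive stay = refl

  shift : Dir → ℕ → ℕ
  shift towardS n = suc n
  shift towardT n = pred n
  shift stay n = n

  parityAfter : Dir → Bool → Bool
  parityAfter stay b = b
  parityAfter towardS b = not b
  parityAfter towardT b = not b

  parityAfter-flip : ∀ d b → parityAfter (flip d) (parityAfter d b) ≡ b
  parityAfter-flip towardS b = not-involutive b
  parityAfter-flip towardT b = not-involutive b
  parityAfter-flip stay b = refl

  -- Interior vertices of path i move one step in direction dir i; sTo = just a sends s to
  -- position L a - 1 of path a, tTo = just b sends t to position 1 of path b.
  record Move : Set where
    constructor move
    field
      dir : Fin k → Dir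
      sTo tTo : Maybe (Fin k)
  open Move public

  sTarget : Maybe (Fin k) → Fin k → Pos
  sTarget nothing i = i , L i
  sTarget (just a) _ = a , pred (L a)

  tTarget : Maybe (Fin k) → Fin k → Pos
  tTarget nothing i = i , 0
  tTarget (just b) _ = b , 1

  moveAt : Move → Fin k → ℕ → Pos
  moveAt m i zero = tTarget (tTo m) i
  moveAt m i (suc n) with suc n ℕ.≟ L i
  ... | yes _ = sTarget (sTo m) i
  ... | no _ = i , shift (dir m i) (suc n)

  data PositionOn (i : Fin k) : ℕ → Set where
    atT : PositionOn i 0
    atS : PositionOn i (L i)
    interior : ∀ {n} → 0 < n → n < L i → PositionOn i n

  positionOn : ∀ i {n} → n ≤ L i → PositionOn i n
  positionOn i {zero} _ = atT
  positionOn i {suc n} n≤L with suc n ℕ.≟ L i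
  ... | yes n≡L = subst (PositionOn i) (sym n≡L) atS
  ... | no n≢L = interior (s≤s z≤n) (ℕ.≤∧≢⇒< n≤L n≢L)

  at-end : ∀ {A : Set} (f : ℕ → A) (b : A) i → (∀ n → suc n ≡ L i → f (suc n) ≡ b) →
           f (L i) ≡ b
  at-end f b i h = go (L i) refl
    where
    go : ∀ l → l ≡ L i → f l ≡ b
    go zero 0≡L = contradiction (sym 0≡L) (L≢0 i)
    go (suc n) eq = h n eq

  occupied-s : ∀ c i → occupied c i (L i) ≡ s∈ c
  occupied-s c i = at-end (occupied c i) (s∈ c) i λ n eq → lemma n eq
    where
    lemma : ∀ n → suc n ≡ L i → occupied c i (suc n) ≡ s∈ c
    lemma n eq with suc n ℕ.≟ L i
    ... | yes _ = refl
    ... | no n≢L = contradiction eq n≢L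

  occupied-interior : ∀ c i {n} → 0 < n → n < L i → occupied c i n ≡ agree (oddIn c i) (odd n)
  occupied-interior c i {suc n} _ n<L with suc n ℕ.≟ L i
  ... | yes n≡L = contradiction n≡L (ℕ.<⇒≢ n<L)
  ... | no _ = refl

  moveAt-s : ∀ m i → moveAt m i (L i) ≡ sTarget (sTo m) i
  moveAt-s m i = at-end (moveAt m i) (sTarget (sTo m) i) i λ n eq → lemma n eq
    where
    lemma : ∀ n → suc n ≡ L i → moveAt m i (suc n) ≡ sTarget (sTo m) i
    lemma n eq with suc n ℕ.≟ L i
    ... | yes _ = refl
    ... | no n≢L = contradiction eq n≢L

  moveAt-interior : ∀ m i {n} → 0 < n → n < L i → moveAt m i n ≡ (i , shift (dir m i) n)
  moveAt-interior m i {suc n} _ n<L with suc n ℕ.≟ L i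
  ... | yes n≡L = contradiction n≡L (ℕ.<⇒≢ n<L)
  ... | no _ = refl

  -- If path i moves toward s and its last interior vertex is occupied (its parity par is that of
  -- L i - 1), this vertex lands on s, which the reverse move must send back onto path i; likewise for t.
  ExitAt : Bool → Config → Move → Fin k → Dir → Set
  ExitAt par c′ m′ i towardS = par ≡ odd (pred (L i)) → s∈ c′ ≡ true × sTo m′ ≡ just i
  ExitAt par c′ m′ i towardT = par ≡ true → t∈ c′ ≡ true × tTo m′ ≡ just i
  ExitAt par c′ m′ i stay = ⊤

  Exit : Config → Config → Move → Fin k → Dir → Set
  Exit c c′ m′ i = ExitAt (oddIn c i) c′ m′ i

  ParityRule : Config → Config → (Fin k → Dir) → Set
  ParityRule c c′ d = ∀ i → 2 ≤ L i → oddIn c′ i ≡ parityAfter (d i) (oddIn c i)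

  ExitRule : Config → Config → (Fin k → Dir) → Move → Set
  ExitRule c c′ d m′ = ∀ i → 2 ≤ L i → Exit c c′ m′ i (d i)

  -- The place where t lands under m is occupied in c′, and m′ brings it back to t.
  TLands : Config → Move → Move → Maybe (Fin k) → Set
  TLands c′ m m′ nothing = t∈ c′ ≡ true × tTo m′ ≡ nothing
  TLands c′ m m′ (just b) = (L b ≡ 1 → s∈ c′ ≡ true × sTo m′ ≡ just b)
                          × (2 ≤ L b → dir m b ≡ towardS × oddIn c′ b ≡ true)

  SLands : Config → Move → Move → Maybe (Fin k) → Set
  SLands c′ m m′ nothing = s∈ c′ ≡ true × sTo m′ ≡ nothing
  SLands c′ m m′ (just a) = (L a ≡ 1 → t∈ c′ ≡ true × tTo m′ ≡ just a)
                          × (2 ≤ L a → dir m a ≡ towardT × oddIn c′ a ≡ odd (pred (L a)))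

  -- m carries the vertices of c onto vertices of c′, and m′ carries each of them back.
  record Reversible (c : Config) (m : Move) (c′ : Config) (m′ : Move) : Set where
    field
      parity : ParityRule c c′ (dir m)
      exits : ExitRule c c′ (dir m) m′
      reverse : ∀ i → dir m′ i ≡ flip (dir m i)
      t-lands : t∈ c ≡ true → TLands c′ m m′ (tTo m)
      s-lands : s∈ c ≡ true → SLands c′ m m′ (sTo m)

  Returns : Config → Move → Pos → Pos → Set
  Returns c′ m′ a (j , n) = occupied c′ j n ≡ true × moveAt m′ j n ≈ₚ a

  occupied-interior⇒parity : ∀ c i {n} → 0 < n → n < L i → occupied c i n ≡ true →
                             oddIn c i ≡ odd n
  occupied-interior⇒parity c i 0<n n<L occ =
    agree⇒≡ _ _ (trans (sym (occupied-interior c i 0<n n<L)) occ)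

  returns-via-s : ∀ {c′ m′} a {n} x → suc n ≡ L a → s∈ c′ ≡ true → sTo m′ ≡ just a → (a , n) ≈ₚ x →
                  Returns c′ m′ x (a , suc n)
  returns-via-s {c′} {m′} a {n} x 1+n≡L s∈c′ sBack a≈x =
    subst (λ l → occupied c′ a l ≡ true) (sym 1+n≡L) (trans (occupied-s c′ a) s∈c′) ,
    subst (λ l → moveAt m′ a l ≈ₚ x) (sym 1+n≡L)
      (subst (_≈ₚ x) (sym (trans (moveAt-s m′ a) (cong (λ z → sTarget z a) sBack)))
        (subst (λ l → (a , l) ≈ₚ x) (cong pred 1+n≡L) a≈x))

  module _ {c m c′ m′} (r : Reversible c m c′ m′) where
    open Reversible r

    returns-t : ∀ i → t∈ c ≡ true → Returns c′ m′ (i , 0) (moveAt m i 0)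
    returns-t i t∈c with tTo m | t-lands t∈c
    ... | nothing | t∈c′ , tBack rewrite tBack = t∈c′ , ≈ₚ-refl
    ... | just b | viaS , viaInterior with L≡1⊎2≤L b
    ...   | inj₁ L≡1 = let (s∈c′ , sBack) = viaS L≡1 in
                       returns-via-s b (i , 0) (sym L≡1) s∈c′ sBack (inj₂ (inj₂ (refl , refl)))
    returns-t i t∈c | just b | viaS , viaInterior | inj₂ 2≤Lb with viaInterior 2≤Lb
    ... | toS , b-odd rewrite moveAt-interior m′ b (s≤s z≤n) 2≤Lb | reverse b | toS =
      trans (occupied-interior c′ b (s≤s z≤n) 2≤Lb) (agree-≡ b-odd refl) ,
      inj₂ (inj₂ (refl , refl))

    returns-s : ∀ i → s∈ c ≡ true → Returns c′ m′ (i , L i) (moveAt m i (L i))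
    returns-s i s∈c rewrite moveAt-s m i with sTo m | s-lands s∈c
    ... | nothing | s∈c′ , sBack rewrite moveAt-s m′ i | sBack = trans (occupied-s c′ i) s∈c′ , ≈ₚ-refl
    ... | just a | viaT , viaInterior with L≡1⊎2≤L a
    ...   | inj₁ L≡1 with viaT L≡1
    ...     | t∈c′ , tBack rewrite L≡1 | tBack = t∈c′ , inj₂ (inj₁ (sym L≡1 , refl))
    returns-s i s∈c | just a | viaT , viaInterior | inj₂ 2≤La with viaInterior 2≤La
    ... | toT , a-parity rewrite moveAt-interior m′ a (0<pred 2≤La) (pred< 2≤La) | reverse a | toT =
      trans (occupied-interior c′ a (0<pred 2≤La) (pred< 2≤La)) (agree-≡ a-parity refl) ,
      inj₂ (inj₁ (suc-pred 2≤La , refl))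
      where
      suc-pred : ∀ {l} → 2 ≤ l → suc (pred l) ≡ l
      suc-pred (s≤s _) = refl

    returns-stay : ∀ i {n} → 0 < n → n < L i → dir m i ≡ stay → oddIn c i ≡ odd n →
                   Returns c′ m′ (i , n) (i , n)
    returns-stay i {n} 0<n n<L d i-par
      rewrite occupied-interior c′ i 0<n n<L | moveAt-interior m′ i 0<n n<L | reverse i
            | parity i (0<n<l⇒2≤l 0<n n<L) | d | i-par = agree-refl (odd n) , ≈ₚ-refl

    returns-towardS : ∀ i {n} → 0 < n → n < L i → dir m i ≡ towardS → oddIn c i ≡ odd n →
                      Returns c′ m′ (i , n) (i , suc n)
    returns-towardS i {n} 0<n n<L d i-par with ℕ.m≤n⇒m<n∨m≡n n<L
    ... | inj₁ 1+n<L
      rewrite occupied-interior c′ i (s≤s z≤n) 1+n<L | moveAt-interior m′ i (s≤s z≤n) 1+n<L | reverse i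
            | parity i (0<n<l⇒2≤l 0<n n<L) | d | i-par = agree-refl (not (odd n)) , ≈ₚ-refl
    ... | inj₂ 1+n≡L =
      let (s∈c′ , sBack) = subst (Exit c c′ m′ i) d (exits i (0<n<l⇒2≤l 0<n n<L))
                                 (trans i-par (cong (λ l → odd (pred l)) 1+n≡L))
      in returns-via-s i (i , n) 1+n≡L s∈c′ sBack ≈ₚ-refl

    returns-towardT : ∀ i {n} → 0 < n → n < L i → dir m i ≡ towardT → oddIn c i ≡ odd n →
                      Returns c′ m′ (i , n) (i , pred n)
    returns-towardT i {suc zero} 0<n n<L d i-par
      with subst (Exit c c′ m′ i) d (exits i (0<n<l⇒2≤l 0<n n<L)) i-par
    ... | t∈c′ , tBack rewrite tBack = t∈c′ , ≈ₚ-refl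
    returns-towardT i {suc (suc n)} 0<n n<L d i-par
      rewrite occupied-interior c′ i (s≤s z≤n) (ℕ.<⇒≤ n<L) | moveAt-interior m′ i (s≤s z≤n) (ℕ.<⇒≤ n<L)
            | reverse i | parity i (0<n<l⇒2≤l 0<n n<L) | d | i-par | not-involutive (odd (suc n)) =
      agree-refl (odd (suc n)) , ≈ₚ-refl

    returns : ∀ i {n} → n ≤ L i → occupied c i n ≡ true → Returns c′ m′ (i , n) (moveAt m i n)
    returns i n≤L occ with positionOn i n≤L
    ... | atT = returns-t i occ
    ... | atS = returns-s i (trans (sym (occupied-s c i)) occ)
    ... | interior 0<n n<L rewrite moveAt-interior m i 0<n n<L with dir m i in d
    ...   | stay = returns-stay i 0<n n<L d (occupied-interior⇒parity c i 0<n n<L occ)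
    ...   | towardS = returns-towardS i 0<n n<L d (occupied-interior⇒parity c i 0<n n<L occ)
    ...   | towardT = returns-towardT i 0<n n<L d (occupied-interior⇒parity c i 0<n n<L occ)

  members : Config → Subset N
  members c = tabulate (λ x → uncurry (occupied c) (position x))

  moveVertex : Move → Fin N → Fin N
  moveVertex m x = uncurry vertexAt (uncurry (moveAt m) (position x))

  InRange : Pos → Set
  InRange (i , n) = n ≤ L i

  occupied-≈ : ∀ c {i n i′ n′} → (i , n) ≈ₚ (i′ , n′) → occupied c i n ≡ occupied c i′ n′
  occupied-≈ c (inj₁ (refl , refl)) = refl
  occupied-≈ c {i} {i′ = i′} (inj₂ (inj₁ (refl , refl))) =
    trans (occupied-s c i) (sym (occupied-s c i′))
  occupied-≈ c (inj₂ (inj₂ (refl , refl))) = refl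

  moveAt-≈ : ∀ m {i n i′ n′} → (i , n) ≈ₚ (i′ , n′) → moveAt m i n ≈ₚ moveAt m i′ n′
  moveAt-≈ m (inj₁ (refl , refl)) = ≈ₚ-refl
  moveAt-≈ m {i} {i′ = i′} (inj₂ (inj₁ (refl , refl))) rewrite moveAt-s m i | moveAt-s m i′ with sTo m
  ... | nothing = inj₂ (inj₁ (refl , refl))
  ... | just _ = ≈ₚ-refl
  moveAt-≈ m (inj₂ (inj₂ (refl , refl))) with tTo m
  ... | nothing = inj₂ (inj₂ (refl , refl))
  ... | just _ = ≈ₚ-refl

  moveAt-inRange : ∀ m i {n} → n ≤ L i → InRange (moveAt m i n)
  moveAt-inRange m i n≤L with positionOn i n≤L
  ... | atT with tTo m
  ...   | nothing = z≤n
  ...   | just b = L≥1 b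
  moveAt-inRange m i n≤L | atS rewrite moveAt-s m i with sTo m
  ...   | nothing = ℕ.≤-refl
  ...   | just a = ℕ.pred[n]≤n
  moveAt-inRange m i n≤L | interior 0<n n<L rewrite moveAt-interior m i 0<n n<L with dir m i
  ...   | towardS = n<L
  ...   | towardT = ℕ.≤-trans ℕ.pred[n]≤n n≤L
  ...   | stay = n≤L

  ∈members⇔occupied : ∀ c i {n} → n ≤ L i → vertexAt i n ∈ members c ⇔ occupied c i n ≡ true
  ∈members⇔occupied c i n≤L = mk⇔
    (λ x∈ → trans (sym (occupied-≈ c (position-vertexAt i n≤L))) (∈tabulate⁻ _ x∈))
    (λ occ → ∈tabulate⁺ _ (trans (occupied-≈ c (position-vertexAt i n≤L)) occ))

  ∈members⇔occupied-toℕ : ∀ c i (j : Fin (suc (L i))) →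
                          p i j ∈ members c ⇔ occupied c i (toℕ j) ≡ true
  ∈members⇔occupied-toℕ c i j = subst (λ x → x ∈ members c ⇔ occupied c i (toℕ j) ≡ true)
                                      (vertexAt-toℕ i j) (∈members⇔occupied c i (Fin.toℕ≤pred[n] j))

  occupied-interior⇔ : ∀ c i {n} → 0 < n → n < L i → occupied c i n ≡ true ⇔ odd n ≡ oddIn c i
  occupied-interior⇔ c i 0<n n<L = mk⇔
    (λ occ → sym (occupied-interior⇒parity c i 0<n n<L occ))
    (λ par → trans (occupied-interior c i 0<n n<L) (agree-≡ refl par))

  occupied-when : ∀ c i {n} → n ≤ L i → (n ≡ 0 → t∈ c ≡ true) → (n ≡ L i → s∈ c ≡ true) →
                  (0 < n → n < L i → odd n ≡ oddIn c i) → occupied c i n ≡ true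
  occupied-when c i n≤L at-t at-s at-interior with positionOn i n≤L
  ... | atT = at-t refl
  ... | atS = trans (occupied-s c i) (at-s refl)
  ... | interior 0<n n<L = from (occupied-interior⇔ c i 0<n n<L) (at-interior 0<n n<L)

  moveVertex-vertexAt : ∀ m i {n} → n ≤ L i →
                        moveVertex m (vertexAt i n) ≡ uncurry vertexAt (moveAt m i n)
  moveVertex-vertexAt m i n≤L = ≈ₚ⇒vertexAt≡ (moveAt-≈ m (position-vertexAt i n≤L))

  module _ {c m c′ m′} (r : Reversible c m c′ m′) where

    private
      returns-position : ∀ {x} → x ∈ members c →
                         Returns c′ m′ (position x) (uncurry (moveAt m) (position x))
      returns-position {x} x∈ = returns r (proj₁ (position x)) (position-≤ x) (∈tabulate⁻ _ x∈)

    moveVertex-∈ : ∀ {x} → x ∈ members c → moveVertex m x ∈ members c′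
    moveVertex-∈ {x} x∈ = from (∈members⇔occupied c′ _ (moveAt-inRange m _ (position-≤ x)))
                                           (proj₁ (returns-position x∈))

    moveVertex-undo : ∀ {x} → x ∈ members c → moveVertex m′ (moveVertex m x) ≡ x
    moveVertex-undo {x} x∈ = begin
      moveVertex m′ (moveVertex m x)           ≡⟨ moveVertex-vertexAt m′ _ (moveAt-inRange m _ (position-≤ x)) ⟩
      uncurry vertexAt (uncurry (moveAt m′) (uncurry (moveAt m) (position x)))
                                               ≡⟨ ≈ₚ⇒vertexAt≡ (proj₂ (returns-position x∈)) ⟩
      uncurry vertexAt (position x)            ≡⟨ vertexAt-position x ⟩
      x                                        ∎
      where open ≡-Reasoning

    moveVertex-injective : ∀ {u u′} → u ∈ members c → u′ ∈ members c →
                           moveVertex m u ≡ moveVertex m u′ → u ≡ u′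
    moveVertex-injective u∈ u′∈ eq =
      trans (sym (moveVertex-undo u∈)) (trans (cong (moveVertex m′) eq) (moveVertex-undo u′∈))

    reversible-∣∣≤ : ∣ members c ∣ ≤ ∣ members c′ ∣
    reversible-∣∣≤ = injection⇒∣p∣≤∣q∣ (moveVertex m) moveVertex-∈ moveVertex-injective

  moveAt-adj : ∀ m i {n} → n ≤ L i →
    uncurry vertexAt (moveAt m i n) ≡ vertexAt i n ⊎ E (vertexAt i n) (uncurry vertexAt (moveAt m i n))
  moveAt-adj m i n≤L with positionOn i n≤L
  ... | atT with tTo m
  ...   | nothing = inj₁ refl
  ...   | just b = inj₂ (subst (λ z → E z (vertexAt b 1)) (trans (vertexAt-0 b) (sym (vertexAt-0 i)))
                                (vertexAt-adj b (L≥1 b)))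
  moveAt-adj m i n≤L | atS rewrite moveAt-s m i with sTo m
  ...   | nothing = inj₁ refl
  ...   | just a = inj₂ (E-sym (subst (E (vertexAt a (pred (L a)))) (trans (vertexAt-end a) (sym (vertexAt-L i)))
                                      (vertexAt-adj a (ℕ.m≤pred[n]⇒suc[m]≤n ⦃ nonZero a ⦄ ℕ.≤-refl))))
    where
    nonZero : ∀ a → ℕ.NonZero (L a)
    nonZero a = ℕ.>-nonZero (L≥1 a)
    vertexAt-end : ∀ a → vertexAt a (suc (pred (L a))) ≡ s
    vertexAt-end a = trans (cong (vertexAt a) (ℕ.suc-pred (L a) ⦃ nonZero a ⦄)) (vertexAt-L a)
  moveAt-adj m i n≤L | interior 0<n n<L rewrite moveAt-interior m i 0<n n<L with dir m i
  ...   | stay = inj₁ refl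
  ...   | towardS = inj₂ (vertexAt-adj i n<L)
  moveAt-adj m i {suc n} n≤L | interior 0<n n<L | towardT = inj₂ (E-sym (vertexAt-adj i (ℕ.<⇒≤ n<L)))

  moveVertex-adj : ∀ m x → moveVertex m x ≡ x ⊎ E x (moveVertex m x)
  moveVertex-adj m x with moveAt-adj m (proj₁ (position x)) (position-≤ x)
  ... | inj₁ eq = inj₁ (trans eq (vertexAt-position x))
  ... | inj₂ adj = inj₂ (subst (λ z → E z (moveVertex m x)) (vertexAt-position x) adj)

  Defends : Config → Move → Fin k → ℕ → Set
  Defends c m i n = (occupied c i n ≡ true × moveAt m i n ≈ₚ (i , suc n))
                  ⊎ (occupied c i (suc n) ≡ true × moveAt m i (suc n) ≈ₚ (i , n))

  defended : ∀ c m i {n n′} → n ≤ L i → occupied c i n ≡ true → moveAt m i n ≈ₚ (i , n′) →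
             vertexAt i n ∈ members c × moveVertex m (vertexAt i n) ≡ vertexAt i n′
  defended c m i n≤L occ m≈ = from (∈members⇔occupied c i n≤L) occ ,
                              trans (moveVertex-vertexAt m i n≤L) (≈ₚ⇒vertexAt≡ m≈)

  defends-edge : ∀ c m {v w i n} → n < L i → EdgeAt v w i n → Defends c m i n →
                 (v ∈ members c × moveVertex m v ≡ w) ⊎ (w ∈ members c × moveVertex m w ≡ v)
  defends-edge c m {i = i} n<L (inj₁ (refl , refl)) (inj₁ (occ , m≈)) =
    inj₁ (defended c m i (ℕ.<⇒≤ n<L) occ m≈)
  defends-edge c m {i = i} n<L (inj₁ (refl , refl)) (inj₂ (occ , m≈)) = inj₂ (defended c m i n<L occ m≈)
  defends-edge c m {i = i} n<L (inj₂ (refl , refl)) (inj₁ (occ , m≈)) =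
    inj₂ (defended c m i (ℕ.<⇒≤ n<L) occ m≈)
  defends-edge c m {i = i} n<L (inj₂ (refl , refl)) (inj₂ (occ , m≈)) = inj₁ (defended c m i n<L occ m≈)

  defends-up : ∀ c m i {n} → 0 < n → n < L i → agree (oddIn c i) (odd n) ≡ true → dir m i ≡ towardS →
               Defends c m i n
  defends-up c m i 0<n n<L occ d rewrite moveAt-interior m i 0<n n<L | d =
    inj₁ (trans (occupied-interior c i 0<n n<L) occ , ≈ₚ-refl)

  defends-down : ∀ c m i {n} → suc n < L i → agree (oddIn c i) (odd (suc n)) ≡ true → dir m i ≡ towardT →
                 Defends c m i n
  defends-down c m i 1+n<L occ d rewrite moveAt-interior m i (s≤s z≤n) 1+n<L | d =
    inj₂ (trans (occupied-interior c i (s≤s z≤n) 1+n<L) occ , ≈ₚ-refl)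

  defends-from-s : ∀ c m i {n} → suc n ≡ L i → s∈ c ≡ true → sTo m ≡ just i → Defends c m i n
  defends-from-s c m i {n} 1+n≡L s∈c sTo≡ =
    inj₂ (subst (λ l → occupied c i l ≡ true) (sym 1+n≡L) (trans (occupied-s c i) s∈c) ,
          subst (λ l → moveAt m i l ≈ₚ (i , n)) (sym 1+n≡L)
            (subst (_≈ₚ (i , n)) (sym (trans (moveAt-s m i) (cong (λ z → sTarget z i) sTo≡)))
              (inj₁ (refl , cong pred (sym 1+n≡L)))))

  defends-from-t : ∀ c m i → t∈ c ≡ true → tTo m ≡ just i → Defends c m i 0
  defends-from-t c m i t∈c tTo≡ rewrite tTo≡ = inj₁ (t∈c , ≈ₚ-refl)

  module _ {c m c′ m′} (r : Reversible c m c′ m′) (r⁻¹ : Reversible c′ m′ c m) where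

    reversible-defense : ∀ {v w i n} → n < L i → EdgeAt v w i n → Defends c m i n →
                         IsDefense G (members c) v w (moveVertex m)
                       × IsImage G (moveVertex m) (members c) (members c′)
    reversible-defense n<L at defends =
      ((λ u _ → moveVertex-adj m u) , (λ _ _ → moveVertex-injective r) , defends-edge c m n<L at defends) ,
      (λ x → mk⇔ (λ x∈ → moveVertex m′ x , moveVertex-∈ r⁻¹ x∈ , moveVertex-undo r⁻¹ x∈)
                 (λ { (u , u∈ , refl) → moveVertex-∈ r u∈ }))

    reversible-∣∣≡ : ∣ members c ∣ ≡ ∣ members c′ ∣
    reversible-∣∣≡ = ℕ.≤-antisym (reversible-∣∣≤ r) (reversible-∣∣≤ r⁻¹)

  record Swap (c c′ : Config) : Set where
    field
      dirs : Fin k → Dir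
      sForth tForth sBack tBack : Maybe (Fin k)
      parity : ParityRule c c′ dirs
      exits : ExitRule c c′ dirs (move (flip ∘ dirs) sBack tBack)
      exits⁻¹ : ExitRule c′ c (flip ∘ dirs) (move dirs sForth tForth)
      t-lands : t∈ c ≡ true → TLands c′ (move dirs sForth tForth) (move (flip ∘ dirs) sBack tBack) tForth
      s-lands : s∈ c ≡ true → SLands c′ (move dirs sForth tForth) (move (flip ∘ dirs) sBack tBack) sForth
      t-lands⁻¹ : t∈ c′ ≡ true → TLands c (move (flip ∘ dirs) sBack tBack) (move dirs sForth tForth) tBack
      s-lands⁻¹ : s∈ c′ ≡ true → SLands c (move (flip ∘ dirs) sBack tBack) (move dirs sForth tForth) sBack

    forward backward : Move
    forward = move dirs sForth tForth
    backward = move (flip ∘ dirs) sBack tBack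

    reversible : Reversible c forward c′ backward
    reversible = record
      { parity = parity ; exits = exits ; reverse = λ _ → refl ; t-lands = t-lands ; s-lands = s-lands }

    reversible⁻¹ : Reversible c′ backward c forward
    reversible⁻¹ = record
      { parity = λ i 2≤L → trans (sym (parityAfter-flip (dirs i) (oddIn c i)))
                                 (cong (parityAfter (flip (dirs i))) (sym (parity i 2≤L)))
      ; exits = exits⁻¹
      ; reverse = λ i → sym (flip-involutive (dirs i))
      ; t-lands = t-lands⁻¹
      ; s-lands = s-lands⁻¹
      }

  swap-∣∣≡ : ∀ {c c′} → Swap c c′ → ∣ members c ∣ ≡ ∣ members c′ ∣
  swap-∣∣≡ sw = reversible-∣∣≡ (Swap.reversible sw) (Swap.reversible⁻¹ sw)

  Escapes : Config → Move → Move → Fin k → ℕ → Set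
  Escapes c g g′ i n = uncurry (occupied c) (moveAt g i n) ≡ false
                     × uncurry (moveAt g′) (moveAt g i n) ≈ₚ (i , n)

  escapes-up : ∀ c g g′ i {n} → 0 < n → suc n < L i → occupied c i n ≡ true →
               dir g i ≡ towardS → dir g′ i ≡ towardT → Escapes c g g′ i n
  escapes-up c g g′ i {n} 0<n 1+n<L occ d d′
    rewrite moveAt-interior g i 0<n (ℕ.<⇒≤ 1+n<L) | d | occupied-interior c i (s≤s z≤n) 1+n<L
          | moveAt-interior g′ i (s≤s z≤n) 1+n<L | d′ | occupied-interior⇒parity c i 0<n (ℕ.<⇒≤ 1+n<L) occ =
    agree-not (odd n) , ≈ₚ-refl

  escapes-down : ∀ c g g′ i {n} → suc (suc n) < L i → occupied c i (suc (suc n)) ≡ true →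
                 dir g i ≡ towardT → dir g′ i ≡ towardS → Escapes c g g′ i (suc (suc n))
  escapes-down c g g′ i {n} 2+n<L occ d d′
    rewrite moveAt-interior g i (s≤s z≤n) 2+n<L | d | occupied-interior c i (s≤s z≤n) (ℕ.<⇒≤ 2+n<L)
          | moveAt-interior g′ i (s≤s z≤n) (ℕ.<⇒≤ 2+n<L) | d′ | occupied-interior⇒parity c i (s≤s z≤n) 2+n<L occ =
    agree-not′ (odd (suc n)) , ≈ₚ-refl

  cover-neighbour : ∀ {C x y} → IsVertexCover G C → E x y → y ∉ C → x ∈ C
  cover-neighbour cover xy y∉C with cover _ _ xy
  ... | inj₁ x∈C = x∈C
  ... | inj₂ y∈C = contradiction y∈C y∉C

  -- Vertices of c outside the cover C are traded for their images under g, which lie outside c.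
  cover-exchange : ∀ c g g′ {C} → IsVertexCover G C →
    (∀ i {n} → n ≤ L i → occupied c i n ≡ true → vertexAt i n ∈ C ⊎ Escapes c g g′ i n) →
    ∣ members c ∣ ≤ ∣ C ∣
  cover-exchange c g g′ {C} cover escapes = exchange⇒∣p∣≤∣q∣ (moveVertex g) trade
    λ x∈ x∉C y∈ y∉C eq → trans (sym (undo x∈ x∉C)) (trans (cong (moveVertex g′) eq) (undo y∈ y∉C))
    where
    module _ {x} (x∈ : x ∈ members c) (x∉C : x ∉ C) where
      i : Fin k
      i = proj₁ (position x)
      n : ℕ
      n = proj₂ (position x)
      target-inRange : InRange (moveAt g i n)
      target-inRange = moveAt-inRange g i (position-≤ x)

      escape : Escapes c g g′ i n
      escape with escapes i (position-≤ x) (∈tabulate⁻ _ x∈)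
      ... | inj₁ x∈C = contradiction (subst (_∈ C) (vertexAt-position x) x∈C) x∉C
      ... | inj₂ esc = esc

      leaves : moveVertex g x ∉ members c
      leaves g[x]∈ = contradiction (trans (sym (to (∈members⇔occupied c _ target-inRange) g[x]∈))
                                           (proj₁ escape)) λ ()

      undo : moveVertex g′ (moveVertex g x) ≡ x
      undo = trans (moveVertex-vertexAt g′ _ target-inRange)
                   (trans (≈ₚ⇒vertexAt≡ (proj₂ escape)) (vertexAt-position x))

    trade : ∀ {x} → x ∈ members c → x ∉ C → moveVertex g x ∈ C × moveVertex g x ∉ members c
    trade {x} x∈ x∉C with moveVertex-adj g x
    ... | inj₁ g[x]≡x = contradiction (subst (_∈ members c) (sym g[x]≡x) x∈) (leaves x∈ x∉C)
    ... | inj₂ adj with cover x (moveVertex g x) adj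
    ...   | inj₁ x∈C = contradiction x∈C x∉C
    ...   | inj₂ g[x]∈C = g[x]∈C , leaves x∈ x∉C

-- The family 𝒰

module Family {G : Graph} {k : ℕ} (M : Melon G k) (e : Fin k)
               (even-e : Even (Melon.L M e)) (odd-o : ∀ i → i ≢ e → Odd (Melon.L M i)) where
  open Graph G using (N; E) renaming (sym to E-sym)
  open Melon M
  open Coordinates M
  open Configurations M

  odd-pred-e : odd (pred (L e)) ≡ true
  odd-pred-e with L e | Even⇒odd≡false even-e | L≢0 e
  ... | zero | _ | L≢0 = contradiction refl L≢0
  ... | suc l | odd-l | _ = not-injective odd-l

  odd-pred-o : ∀ {i} → i ≢ e → odd (pred (L i)) ≡ false
  odd-pred-o {i} i≢e with L i | Odd⇒odd≡true (odd-o i i≢e) | L≢0 i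
  ... | zero | _ | L≢0 = contradiction refl L≢0
  ... | suc l | odd-l | _ = not-injective odd-l

  2≤L-e : 2 ≤ L e
  2≤L-e with L e | Even⇒odd≡false even-e | L≢0 e
  ... | zero | _ | L≢0 = contradiction refl L≢0
  ... | suc zero | () | _
  ... | suc (suc _) | _ | _ = s≤s (s≤s z≤n)

  L-e≢1 : L e ≢ 1
  L-e≢1 L≡1 = contradiction (subst (2 ≤_) L≡1 2≤L-e) λ { (s≤s ()) }

  -- A value for the even path, and values for the odd paths inside and outside σ.
  byKind : {A : Set} → A → A → A → (Fin k → Bool) → Fin k → A
  byKind aₑ a₁ a₀ σ i with i Fin.≟ e
  ... | yes _ = aₑ
  ... | no _ = if σ i then a₁ else a₀

  byRole : {A : Set} → Fin k → A → A → A → A → (Fin k → Bool) → Fin k → A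
  byRole o aₒ aₑ a₁ a₀ σ i with i Fin.≟ o | i Fin.≟ e
  ... | yes _ | _ = aₒ
  ... | no _ | yes _ = aₑ
  ... | no _ | no _ = if σ i then a₁ else a₀

  byKind-e : ∀ {A : Set} {aₑ a₁ a₀ : A} σ → byKind aₑ a₁ a₀ σ e ≡ aₑ
  byKind-e σ rewrite ≡-≟-identity Fin._≟_ (refl {x = e}) = refl

  byKind-odd : ∀ {A : Set} {aₑ a₁ a₀ : A} σ {i} → i ≢ e →
               byKind aₑ a₁ a₀ σ i ≡ (if σ i then a₁ else a₀)
  byKind-odd σ i≢e rewrite ≢-≟-identity Fin._≟_ i≢e = refl

  byKind-σ : ∀ {A : Set} {aₑ a₁ a₀ : A} σ {i b} → i ≢ e → σ i ≡ b →
             byKind aₑ a₁ a₀ σ i ≡ (if b then a₁ else a₀)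
  byKind-σ σ i≢e refl = byKind-odd σ i≢e

  byRole-o : ∀ {A : Set} o {aₒ aₑ a₁ a₀ : A} σ → byRole o aₒ aₑ a₁ a₀ σ o ≡ aₒ
  byRole-o o σ rewrite ≡-≟-identity Fin._≟_ (refl {x = o}) = refl

  byRole-e : ∀ {A : Set} {o} {aₒ aₑ a₁ a₀ : A} σ → o ≢ e → byRole o aₒ aₑ a₁ a₀ σ e ≡ aₑ
  byRole-e σ o≢e
    rewrite ≢-≟-identity Fin._≟_ (o≢e ∘ sym) | ≡-≟-identity Fin._≟_ (refl {x = e}) = refl

  Uₛ Uₜ : Config
  Uₛ = config true false (λ _ → true)
  Uₜ = config false true (λ i → does (i Fin.≟ e))

  -- U[ σ ] is U_S for S the set of odd paths i with σ i ≡ true; the value σ e is irrelevant.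
  U[_] : (Fin k → Bool) → Config
  U[ σ ] = config true true (byKind false true false σ)

  oddIn-Uₜ-e : oddIn Uₜ e ≡ true
  oddIn-Uₜ-e rewrite ≡-≟-identity Fin._≟_ (refl {x = e}) = refl

  oddIn-Uₜ-o : ∀ {i} → i ≢ e → oddIn Uₜ i ≡ false
  oddIn-Uₜ-o i≢e rewrite ≢-≟-identity Fin._≟_ i≢e = refl

  oddIn-U[σ] : ∀ σ {i b} → i ≢ e → σ i ≡ b → oddIn U[ σ ] i ≡ b
  oddIn-U[σ] σ {b = true} i≢e σi = byKind-σ σ i≢e σi
  oddIn-U[σ] σ {b = false} i≢e σi = byKind-σ σ i≢e σi

  false≢odd-pred-e : false ≢ odd (pred (L e))
  false≢odd-pred-e eq = contradiction (trans eq odd-pred-e) λ ()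

  true≢odd-pred-o : ∀ {i} → i ≢ e → true ≢ odd (pred (L i))
  true≢odd-pred-o i≢e eq = contradiction (trans eq (odd-pred-o i≢e)) λ ()

  -- Moves from U_S to U_s or U_t; their inverses are the moves out of U_s and U_t.
  swapA : ∀ σ → Swap U[ σ ] Uₛ
  swapA σ = record
    { dirs = d ; sForth = nothing ; tForth = just e ; sBack = nothing ; tBack = nothing
    ; parity = parity ; exits = exits ; exits⁻¹ = exits⁻¹
    ; t-lands = λ _ → (λ L≡1 → contradiction L≡1 L-e≢1) , (λ _ → byKind-e σ , refl)
    ; s-lands = λ _ → refl , refl
    ; t-lands⁻¹ = λ ()
    ; s-lands⁻¹ = λ _ → refl , refl
    }
    where
    d : Fin k → Dir
    d = byKind towardS stay towardT σ
    parity : ParityRule U[ σ ] Uₛ d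
    parity i _ with i Fin.≟ e
    ... | yes _ = refl
    ... | no _ with σ i
    ...   | true = refl
    ...   | false = refl
    exits : ExitRule U[ σ ] Uₛ d (move (flip ∘ d) nothing nothing)
    exits i _ with i Fin.≟ e
    ... | yes refl = λ eq → contradiction eq false≢odd-pred-e
    ... | no _ with σ i
    ...   | true = tt
    ...   | false = λ ()
    exits⁻¹ : ExitRule Uₛ U[ σ ] (flip ∘ d) (move d nothing (just e))
    exits⁻¹ i _ with i Fin.≟ e
    ... | yes refl = λ _ → refl , refl
    ... | no i≢e with σ i
    ...   | true = tt
    ...   | false = λ eq → contradiction eq (true≢odd-pred-o i≢e)

  swapB : ∀ σ → Swap U[ σ ] Uₜ
  swapB σ = record
    { dirs = d ; sForth = just e ; tForth = nothing ; sBack = nothing ; tBack = nothing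
    ; parity = parity ; exits = exits ; exits⁻¹ = exits⁻¹
    ; t-lands = λ _ → refl , refl
    ; s-lands = λ _ → (λ L≡1 → contradiction L≡1 L-e≢1) ,
                      (λ _ → byKind-e σ , trans oddIn-Uₜ-e (sym odd-pred-e))
    ; t-lands⁻¹ = λ _ → refl , refl
    ; s-lands⁻¹ = λ ()
    }
    where
    d : Fin k → Dir
    d = byKind towardT towardS stay σ
    parity : ParityRule U[ σ ] Uₜ d
    parity i _ with i Fin.≟ e
    ... | yes _ = refl
    ... | no _ with σ i
    ...   | true = refl
    ...   | false = refl
    exits : ExitRule U[ σ ] Uₜ d (move (flip ∘ d) nothing nothing)
    exits i _ with i Fin.≟ e
    ... | yes refl = λ ()
    ... | no i≢e with σ i
    ...   | true = λ eq → contradiction eq (true≢odd-pred-o i≢e)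
    ...   | false = tt
    exits⁻¹ : ExitRule Uₜ U[ σ ] (flip ∘ d) (move d (just e) nothing)
    exits⁻¹ i _ with i Fin.≟ e
    ... | yes refl = λ _ → refl , refl
    ... | no _ with σ i
    ...   | true = λ ()
    ...   | false = tt

  swapC : ∀ σ {o} → o ≢ e → σ o ≡ true → Swap U[ σ ] Uₜ
  swapC σ {o} o≢e σo = record
    { dirs = d ; sForth = just o ; tForth = just e ; sBack = nothing ; tBack = just o
    ; parity = parity ; exits = exits ; exits⁻¹ = exits⁻¹
    ; t-lands = λ _ → (λ L≡1 → contradiction L≡1 L-e≢1) ,
                      (λ _ → byRole-e σ o≢e , oddIn-Uₜ-e)
    ; s-lands = λ _ → (λ _ → refl , refl) ,
                      (λ _ → byRole-o o σ , trans (oddIn-Uₜ-o o≢e) (sym (odd-pred-o o≢e)))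
    ; t-lands⁻¹ = λ _ → (λ _ → refl , refl) ,
                        (λ _ → cong flip (byRole-o o σ) , oddIn-U[σ] σ o≢e σo)
    ; s-lands⁻¹ = λ ()
    }
    where
    d : Fin k → Dir
    d = byRole o towardT towardS towardS stay σ
    parity : ParityRule U[ σ ] Uₜ d
    parity i _ with i Fin.≟ o | i Fin.≟ e
    ... | yes refl | yes refl = contradiction refl o≢e
    ... | yes refl | no _ rewrite σo = refl
    ... | no _ | yes _ = refl
    ... | no _ | no _ with σ i
    ...   | true = refl
    ...   | false = refl
    exits : ExitRule U[ σ ] Uₜ d (move (flip ∘ d) nothing (just o))
    exits i _ with i Fin.≟ o | i Fin.≟ e
    ... | yes refl | yes refl = contradiction refl o≢e
    ... | yes refl | no _ = λ _ → refl , refl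
    ... | no _ | yes refl = λ eq → contradiction eq false≢odd-pred-e
    ... | no _ | no i≢e with σ i
    ...   | true = λ eq → contradiction eq (true≢odd-pred-o i≢e)
    ...   | false = tt
    exits⁻¹ : ExitRule Uₜ U[ σ ] (flip ∘ d) (move d (just o) (just e))
    exits⁻¹ i _ with i Fin.≟ o | i Fin.≟ e
    ... | yes refl | yes refl = contradiction refl o≢e
    ... | yes refl | no _ = λ _ → refl , refl
    ... | no _ | yes refl = λ _ → refl , refl
    ... | no _ | no _ with σ i
    ...   | true = λ ()
    ...   | false = tt

  swapD : ∀ σ {o} → o ≢ e → σ o ≡ false → Swap U[ σ ] Uₛ
  swapD σ {o} o≢e σo = record
    { dirs = d ; sForth = just e ; tForth = just o ; sBack = just o ; tBack = nothing
    ; parity = parity ; exits = exits ; exits⁻¹ = exits⁻¹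
    ; t-lands = λ _ → (λ _ → refl , refl) , (λ _ → byRole-o o σ , refl)
    ; s-lands = λ _ → (λ L≡1 → contradiction L≡1 L-e≢1) ,
                      (λ _ → byRole-e σ o≢e , sym odd-pred-e)
    ; t-lands⁻¹ = λ ()
    ; s-lands⁻¹ = λ _ → (λ _ → refl , refl) ,
                        (λ _ → cong flip (byRole-o o σ) ,
                               trans (oddIn-U[σ] σ o≢e σo) (sym (odd-pred-o o≢e)))
    }
    where
    d : Fin k → Dir
    d = byRole o towardS towardT stay towardT σ
    parity : ParityRule U[ σ ] Uₛ d
    parity i _ with i Fin.≟ o | i Fin.≟ e
    ... | yes refl | yes refl = contradiction refl o≢e
    ... | yes refl | no _ rewrite σo = refl
    ... | no _ | yes _ = refl
    ... | no _ | no _ with σ i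
    ...   | true = refl
    ...   | false = refl
    exits : ExitRule U[ σ ] Uₛ d (move (flip ∘ d) (just o) nothing)
    exits i _ with i Fin.≟ o | i Fin.≟ e
    ... | yes refl | yes refl = contradiction refl o≢e
    ... | yes refl | no _ = λ _ → refl , refl
    ... | no _ | yes refl = λ ()
    ... | no _ | no _ with σ i
    ...   | true = tt
    ...   | false = λ ()
    exits⁻¹ : ExitRule Uₛ U[ σ ] (flip ∘ d) (move d (just e) (just o))
    exits⁻¹ i _ with i Fin.≟ o | i Fin.≟ e
    ... | yes refl | yes refl = contradiction refl o≢e
    ... | yes refl | no _ = λ _ → refl , refl
    ... | no _ | yes refl = λ _ → refl , refl
    ... | no _ | no i≢e with σ i
    ...   | true = tt
    ...   | false = λ eq → contradiction eq (true≢odd-pred-o i≢e)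

  only allBut : Fin k → Fin k → Bool
  only o i = does (i Fin.≟ o)
  allBut o i = not (only o i)

  only-o : ∀ o → only o o ≡ true
  only-o o rewrite ≡-≟-identity Fin._≟_ (refl {x = o}) = refl

  only-≢ : ∀ {o i} → i ≢ o → only o i ≡ false
  only-≢ i≢o rewrite ≢-≟-identity Fin._≟_ i≢o = refl

  NonemptyProper : (Fin k → Bool) → Set
  NonemptyProper σ = (∃[ o ] (o ≢ e × σ o ≡ true)) × (∃[ o ] (o ≢ e × σ o ≡ false))

  data InFamily : Config → Set where
    Uₛ∈ : InFamily Uₛ
    Uₜ∈ : InFamily Uₜ
    U[σ]∈ : ∀ {σ} → NonemptyProper σ → InFamily U[ σ ]

  -- A defense, staying inside the family, of the edge between positions n and n + 1 of path i.
  record Step (c : Config) (i : Fin k) (n : ℕ) : Set where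
    field
      {target} : Config
      inFamily : InFamily target
      forth back : Move
      reversible : Reversible c forth target back
      reversible⁻¹ : Reversible target back c forth
      defends : Defends c forth i n

  forthStep : ∀ {c c′ i n} (sw : Swap c c′) → InFamily c′ → Defends c (Swap.forward sw) i n → Step c i n
  forthStep sw c′∈ d = record
    { inFamily = c′∈ ; reversible = Swap.reversible sw ; reversible⁻¹ = Swap.reversible⁻¹ sw ; defends = d }

  backStep : ∀ {c c′ i n} (sw : Swap c c′) → InFamily c → Defends c′ (Swap.backward sw) i n → Step c′ i n
  backStep sw c∈ d = record
    { inFamily = c∈ ; reversible = Swap.reversible⁻¹ sw ; reversible⁻¹ = Swap.reversible sw ; defends = d }

  1+n<L-e : ∀ {n} → n < L e → odd n ≡ false → suc n < L e
  1+n<L-e n<L odd-n = ℕ.≤∧≢⇒< n<L λ 1+n≡L →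
    contradiction (trans (sym (cong not odd-n)) (trans (cong odd 1+n≡L) (Even⇒odd≡false even-e)))
                  λ ()

  1+n<L-o : ∀ {i n} → i ≢ e → n < L i → odd n ≡ true → suc n < L i
  1+n<L-o {i} i≢e n<L odd-n = ℕ.≤∧≢⇒< n<L λ 1+n≡L →
    contradiction (trans (sym (cong not odd-n)) (trans (cong odd 1+n≡L) (Odd⇒odd≡true (odd-o i i≢e))))
                  λ ()

  odd⇒0< : ∀ {n} → odd n ≡ true → 0 < n
  odd⇒0< {suc n} _ = s≤s z≤n

  Odd⇒≢L-e : ∀ {n} → Odd n → n ≢ L e
  Odd⇒≢L-e od refl = ¬Even∧Odd even-e od

  Even⇒≢L-o : ∀ {i n} → i ≢ e → Even n → n ≢ L i
  Even⇒≢L-o {i} i≢e ev refl = ¬Even∧Odd ev (odd-o i i≢e)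

  members-Uₛ : ∀ x → x ∈ members Uₛ ⇔ InUs M e x
  members-Uₛ x = mk⇔
    (λ x∈ → subst (InUs M e) (vertexAt-position x)
                  (occupied⇒InUs _ (position-≤ x) (∈tabulate⁻ _ x∈)))
    λ { (inj₁ refl) → subst (_∈ members Uₛ) (vertexAt-L e)
                        (from (∈members⇔occupied Uₛ e ℕ.≤-refl) (occupied-s Uₛ e))
      ; (inj₂ (inj₁ (j , refl , od))) → odd∈ e j od
      ; (inj₂ (inj₂ (o , _ , j , refl , od))) → odd∈ o j od }
    where
    occupied⇒InUs : ∀ i {n} → n ≤ L i → occupied Uₛ i n ≡ true → InUs M e (vertexAt i n)
    occupied⇒InUs i n≤L occ with positionOn i n≤L
    ... | atT = contradiction occ λ ()
    ... | atS = inj₁ (vertexAt-L i)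
    ... | interior {n} 0<n n<L with i Fin.≟ e
    ...   | yes refl = inj₂ (inj₁ (vertexAt-OddPos e n≤L od))
      where
      od : Odd n
      od = odd≡true⇒Odd n (sym (occupied-interior⇒parity Uₛ e 0<n n<L occ))
    ...   | no i≢e = inj₂ (inj₂ (i , i≢e , vertexAt-OddPos i n≤L od))
      where
      od : Odd n
      od = odd≡true⇒Odd n (sym (occupied-interior⇒parity Uₛ i 0<n n<L occ))
    odd∈ : ∀ i j → Odd (toℕ j) → p i j ∈ members Uₛ
    odd∈ i j od = from (∈members⇔occupied-toℕ Uₛ i j)
      (occupied-when Uₛ i (Fin.toℕ≤pred[n] j) (λ j≡0 → ⊥-elim (¬Odd0 (subst Odd j≡0 od)))
                     (λ _ → refl) (λ _ _ → Odd⇒odd≡true od))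

  members-Uₜ : ∀ x → x ∈ members Uₜ ⇔ InUt M e x
  members-Uₜ x = mk⇔
    (λ x∈ → subst (InUt M e) (vertexAt-position x)
                  (occupied⇒InUt _ (position-≤ x) (∈tabulate⁻ _ x∈)))
    λ { (inj₁ refl) → subst (_∈ members Uₜ) (vertexAt-0 e) (from (∈members⇔occupied Uₜ e z≤n) refl)
      ; (inj₂ (inj₁ (j , refl , od))) → from (∈members⇔occupied-toℕ Uₜ e j)
          (occupied-when Uₜ e (Fin.toℕ≤pred[n] j) (λ j≡0 → ⊥-elim (¬Odd0 (subst Odd j≡0 od)))
                         (λ j≡L → contradiction j≡L (Odd⇒≢L-e od))
                         (λ _ _ → trans (Odd⇒odd≡true od) (sym oddIn-Uₜ-e)))
      ; (inj₂ (inj₂ (o , o≢e , j , refl , ev))) → from (∈members⇔occupied-toℕ Uₜ o j)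
          (occupied-when Uₜ o (Fin.toℕ≤pred[n] j) (λ _ → refl)
                         (λ j≡L → contradiction j≡L (Even⇒≢L-o o≢e ev))
                         (λ _ _ → trans (Even⇒odd≡false ev) (sym (oddIn-Uₜ-o o≢e)))) }
    where
    occupied⇒InUt : ∀ i {n} → n ≤ L i → occupied Uₜ i n ≡ true → InUt M e (vertexAt i n)
    occupied⇒InUt i n≤L occ with positionOn i n≤L
    ... | atT = inj₁ (vertexAt-0 i)
    ... | atS = contradiction (trans (sym (occupied-s Uₜ i)) occ) λ ()
    ... | interior {n} 0<n n<L with i Fin.≟ e
    ...   | yes refl = inj₂ (inj₁ (vertexAt-OddPos e n≤L (odd≡true⇒Odd n
              (trans (sym (occupied-interior⇒parity Uₜ e 0<n n<L occ)) oddIn-Uₜ-e))))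
    ...   | no i≢e = inj₂ (inj₂ (i , i≢e , vertexAt-EvenPos i n≤L (odd≡false⇒Even n
              (trans (sym (occupied-interior⇒parity Uₜ i 0<n n<L occ)) (oddIn-Uₜ-o i≢e)))))

  members-U[σ] : ∀ σ → IsUS M e (tabulate (oddIn U[ σ ])) (members U[ σ ])
  members-U[σ] σ = internal , s-path , t-path
    where
    internal : IsInternal M e (members U[ σ ])
    internal x = mk⇔
      (λ { (x∈ , j , refl) → j , refl , odd≡false⇒Even _
             (parity (Fin.toℕ≤pred[n] j) (to (∈members⇔occupied-toℕ _ e j) x∈)) })
      (λ { (j , refl , ev) → from (∈members⇔occupied-toℕ _ e j)
             (occupied-when _ e (Fin.toℕ≤pred[n] j) (λ _ → refl) (λ _ → refl)
                            (λ _ _ → trans (Even⇒odd≡false ev) (sym (byKind-e σ)))) ,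
             j , refl })
      where
      parity : ∀ {n} → n ≤ L e → occupied U[ σ ] e n ≡ true → odd n ≡ false
      parity n≤L occ with positionOn e n≤L
      ... | atT = refl
      ... | atS = Even⇒odd≡false even-e
      ... | interior 0<n n<L = trans (sym (occupied-interior⇒parity _ e 0<n n<L occ)) (byKind-e σ)

    s-path : ∀ o → o ≢ e → o ∈ tabulate (oddIn U[ σ ]) → IsSPath M o (members U[ σ ])
    s-path o o≢e o∈S x = mk⇔
      (λ { (x∈ , (j , refl) , x≢t) → j , refl , odd≡true⇒Odd _
             (parity (p≢t⇒0<toℕ o j x≢t) (Fin.toℕ≤pred[n] j) (to (∈members⇔occupied-toℕ _ o j) x∈)) })
      (λ { (j , refl , od) → from (∈members⇔occupied-toℕ _ o j)
             (occupied-when _ o (Fin.toℕ≤pred[n] j) (λ j≡0 → ⊥-elim (¬Odd0 (subst Odd j≡0 od)))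
                            (λ _ → refl) (λ _ _ → trans (Odd⇒odd≡true od) (sym oddIn≡))) ,
             (j , refl) , λ pj≡t → ¬Odd0 (subst Odd (p≡t⇒toℕ≡0 o j pj≡t) od) })
      where
      oddIn≡ : oddIn U[ σ ] o ≡ true
      oddIn≡ = ∈tabulate⁻ _ o∈S
      parity : ∀ {n} → 0 < n → n ≤ L o → occupied U[ σ ] o n ≡ true → odd n ≡ true
      parity 0<n n≤L occ with positionOn o n≤L
      ... | atT = contradiction 0<n λ ()
      ... | atS = Odd⇒odd≡true (odd-o o o≢e)
      ... | interior 0<n n<L = trans (sym (occupied-interior⇒parity _ o 0<n n<L occ)) oddIn≡

    t-path : ∀ o → o ≢ e → o ∉ tabulate (oddIn U[ σ ]) → IsTPath M o (members U[ σ ])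
    t-path o o≢e o∉S x = mk⇔
      (λ { (x∈ , (j , refl) , x≢s) → j , refl , odd≡false⇒Even _
             (parity (p≢s⇒toℕ<L o j x≢s) (to (∈members⇔occupied-toℕ _ o j) x∈)) })
      (λ { (j , refl , ev) → from (∈members⇔occupied-toℕ _ o j)
             (occupied-when _ o (Fin.toℕ≤pred[n] j) (λ _ → refl)
                            (λ j≡L → contradiction j≡L (Even⇒≢L-o o≢e ev))
                            (λ _ _ → trans (Even⇒odd≡false ev) (sym oddIn≡))) ,
             (j , refl) , λ pj≡s → Even⇒≢L-o o≢e ev (p≡s⇒toℕ≡L o j pj≡s) })
      where
      oddIn≡ : oddIn U[ σ ] o ≡ false
      oddIn≡ with oddIn U[ σ ] o in eq
      ... | true = contradiction (∈tabulate⁺ _ eq) o∉S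
      ... | false = refl
      parity : ∀ {n} → n < L o → occupied U[ σ ] o n ≡ true → odd n ≡ false
      parity {n} n<L occ with positionOn o (ℕ.<⇒≤ n<L)
      ... | atT = refl
      ... | atS = contradiction n<L (ℕ.<-irrefl refl)
      ... | interior 0<n n<L = trans (sym (occupied-interior⇒parity _ o 0<n n<L occ)) oddIn≡

  family-𝒰 : ∀ {c} → InFamily c → 𝒰fam M e (members c)
  family-𝒰 Uₛ∈ = inj₁ members-Uₛ
  family-𝒰 Uₜ∈ = inj₂ (inj₁ members-Uₜ)
  family-𝒰 (U[σ]∈ {σ} ((o , o≢e , σo) , (o′ , o′≢e , σo′))) =
    inj₂ (inj₂ (tabulate (oddIn U[ σ ]) , (odd-only , (o , o∈) , (o′ , o′≢e , o′∉)) , members-U[σ] σ))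
    where
    odd-only : ∀ i → i ∈ tabulate (oddIn U[ σ ]) → i ≢ e
    odd-only i i∈ refl = contradiction (trans (sym (∈tabulate⁻ _ i∈)) (byKind-e σ)) λ ()
    o∈ : o ∈ tabulate (oddIn U[ σ ])
    o∈ = ∈tabulate⁺ _ (oddIn-U[σ] σ o≢e σo)
    o′∉ : o′ ∉ tabulate (oddIn U[ σ ])
    o′∉ o′∈ = contradiction (trans (sym (∈tabulate⁻ _ o′∈)) (oddIn-U[σ] σ o′≢e σo′)) λ ()

  IsUS-⊆ : ∀ {S S′ U V} → IsUS M e S U → IsUS M e S′ V →
           (∀ o → o ≢ e → o ∈ S → o ∈ S′) → (∀ o → o ≢ e → o ∉ S → o ∉ S′) → U ⊆ V
  IsUS-⊆ {S} (int-U , s-U , t-U) (int-V , s-V , t-V) S⊆S′ S∁⊆S′∁ {x} x∈U with cover-V x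
  ... | i , j , pj≡x with i Fin.≟ e
  ...   | yes refl = proj₁ (from (int-V x) (to (int-U x) (x∈U , j , pj≡x)))
  ...   | no i≢e with i ∈? S
  ...     | yes i∈S with x Fin.≟ t
  ...       | yes refl = proj₁ (from (int-V t) (Fin.zero , start e , 0 , refl))
  ...       | no x≢t = proj₁ (from (s-V i i≢e (S⊆S′ i i≢e i∈S) x) (to (s-U i i≢e i∈S x) (x∈U , (j , pj≡x) , x≢t)))
  IsUS-⊆ (int-U , s-U , t-U) (int-V , s-V , t-V) S⊆S′ S∁⊆S′∁ {x} x∈U | i , j , pj≡x | no i≢e | no i∉S
    with x Fin.≟ s
  ... | yes refl = proj₁ (from (int-V s) (fromℕ (L e) , end e , subst Even (sym (Fin.toℕ-fromℕ (L e))) even-e))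
  ... | no x≢s = proj₁ (from (t-V i i≢e (S∁⊆S′∁ i i≢e i∉S) x) (to (t-U i i≢e i∉S x) (x∈U , (j , pj≡x) , x≢s)))

  𝒰-family : ∀ {U} → 𝒰fam M e U → ∃[ c ] (InFamily c × U ≡ members c)
  𝒰-family {U} (inj₁ U≡Us) =
    Uₛ , Uₛ∈ , ⊆-antisym (λ {x} x∈ → from (members-Uₛ x) (to (U≡Us x) x∈))
                         (λ {x} x∈ → from (U≡Us x) (to (members-Uₛ x) x∈))
  𝒰-family {U} (inj₂ (inj₁ U≡Ut)) =
    Uₜ , Uₜ∈ , ⊆-antisym (λ {x} x∈ → from (members-Uₜ x) (to (U≡Ut x) x∈))
                         (λ {x} x∈ → from (U≡Ut x) (to (members-Uₜ x) x∈))
  𝒰-family {U} (inj₂ (inj₂ (S , (S-odd , (o , o∈S) , (o′ , o′≢e , o′∉S)) , U≡US))) =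
    U[ σ ] , U[σ]∈ ((o , S-odd o o∈S , σ-in o∈S) , (o′ , o′≢e , σ-out o′∉S)) ,
    ⊆-antisym (IsUS-⊆ U≡US (members-U[σ] σ) S⊆ S∁⊆) (IsUS-⊆ (members-U[σ] σ) U≡US ⊆S ∁⊆S∁)
    where
    σ : Fin k → Bool
    σ i = does (i ∈? S)
    σ-in : ∀ {i} → i ∈ S → σ i ≡ true
    σ-in {i} i∈S with i ∈? S
    ... | yes _ = refl
    ... | no i∉S = contradiction i∈S i∉S
    σ-out : ∀ {i} → i ∉ S → σ i ≡ false
    σ-out {i} i∉S with i ∈? S
    ... | yes i∈S = contradiction i∈S i∉S
    ... | no _ = refl
    S′ : Subset k
    S′ = tabulate (oddIn U[ σ ])
    S⊆ : ∀ i → i ≢ e → i ∈ S → i ∈ S′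
    S⊆ i i≢e i∈S = ∈tabulate⁺ _ (oddIn-U[σ] σ i≢e (σ-in i∈S))
    S∁⊆ : ∀ i → i ≢ e → i ∉ S → i ∉ S′
    S∁⊆ i i≢e i∉S i∈S′ =
      contradiction (trans (sym (∈tabulate⁻ _ i∈S′)) (oddIn-U[σ] σ i≢e (σ-out i∉S))) λ ()
    ⊆S : ∀ i → i ≢ e → i ∈ S′ → i ∈ S
    ⊆S i i≢e i∈S′ with i ∈? S
    ... | yes i∈S = i∈S
    ... | no i∉S = contradiction i∈S′ (S∁⊆ i i≢e i∉S)
    ∁⊆S∁ : ∀ i → i ≢ e → i ∉ S′ → i ∉ S
    ∁⊆S∁ i i≢e i∉S′ i∈S = i∉S′ (S⊆ i i≢e i∈S)

  module WithThreePaths (3≤k : 3 ≤ k) where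

    allBut-nonemptyProper : ∀ {o} → o ≢ e → NonemptyProper (allBut o)
    allBut-nonemptyProper {o} o≢e =
      let (c , c≢e , c≢o) = ∃-≢₂ 3≤k e o in (c , c≢e , cong not (only-≢ c≢o)) , (o , o≢e , cong not (only-o o))

    only-nonemptyProper : ∀ {o} → o ≢ e → NonemptyProper (only o)
    only-nonemptyProper {o} o≢e =
      let (c , c≢e , c≢o) = ∃-≢₂ 3≤k e o in (o , o≢e , only-o o) , (c , c≢e , only-≢ c≢o)

    o₀ : Fin k
    o₀ = proj₁ (∃-≢₂ 3≤k e e)

    o₀≢e : o₀ ≢ e
    o₀≢e = proj₁ (proj₂ (∃-≢₂ 3≤k e e))

    steps-Uₛ : ∀ i {n} → n < L i → Step Uₛ i n
    steps-Uₛ i {n} n<L with i Fin.≟ e | odd n in odd-n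
    ... | yes refl | true =
      backStep (swapD σ o₀≢e (cong not (only-o o₀))) (U[σ]∈ (allBut-nonemptyProper o₀≢e))
        (defends-up Uₛ _ e (odd⇒0< odd-n) n<L odd-n (cong flip (byRole-e σ o₀≢e)))
      where
      σ : Fin k → Bool
      σ = allBut o₀
    ... | yes refl | false =
      backStep (swapA σ) (U[σ]∈ (allBut-nonemptyProper o₀≢e))
        (defends-down Uₛ _ e (1+n<L-e n<L odd-n) (cong not odd-n) (cong flip (byKind-e σ)))
      where
      σ : Fin k → Bool
      σ = allBut o₀
    ... | no i≢e | true =
      backStep (swapA σ) (U[σ]∈ (allBut-nonemptyProper i≢e))
        (defends-up Uₛ _ i (odd⇒0< odd-n) n<L odd-n (cong flip (byKind-σ σ i≢e (cong not (only-o i)))))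
      where
      σ : Fin k → Bool
      σ = allBut i
    ... | no i≢e | false with ℕ.m≤n⇒m<n∨m≡n n<L
    ...   | inj₁ 1+n<L =
      backStep (swapD (allBut i) i≢e (cong not (only-o i))) (U[σ]∈ (allBut-nonemptyProper i≢e))
        (defends-down Uₛ _ i 1+n<L (cong not odd-n) (cong flip (byRole-o i (allBut i))))
    ...   | inj₂ 1+n≡L =
      backStep (swapD (allBut i) i≢e (cong not (only-o i))) (U[σ]∈ (allBut-nonemptyProper i≢e))
        (defends-from-s Uₛ _ i 1+n≡L refl refl)

    steps-Uₜ : ∀ i {n} → n < L i → Step Uₜ i n
    steps-Uₜ i {n} n<L with i Fin.≟ e | odd n in odd-n
    ... | yes refl | true =
      backStep (swapB σ) (U[σ]∈ (only-nonemptyProper o₀≢e))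
        (defends-up Uₜ _ e (odd⇒0< odd-n) n<L (agree-≡ oddIn-Uₜ-e odd-n) (cong flip (byKind-e σ)))
      where
      σ : Fin k → Bool
      σ = only o₀
    ... | yes refl | false =
      backStep (swapC σ o₀≢e (only-o o₀)) (U[σ]∈ (only-nonemptyProper o₀≢e))
        (defends-down Uₜ _ e (1+n<L-e n<L odd-n) (agree-≡ oddIn-Uₜ-e (cong not odd-n))
                      (cong flip (byRole-e σ o₀≢e)))
      where
      σ : Fin k → Bool
      σ = only o₀
    ... | no i≢e | true =
      backStep (swapB σ) (U[σ]∈ (only-nonemptyProper i≢e))
        (defends-down Uₜ _ i (1+n<L-o i≢e n<L odd-n) (agree-≡ (oddIn-Uₜ-o i≢e) (cong not odd-n))
                      (cong flip (byKind-σ σ i≢e (only-o i))))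
      where
      σ : Fin k → Bool
      σ = only i
    steps-Uₜ i {zero} n<L | no i≢e | false =
      backStep (swapC (only i) i≢e (only-o i)) (U[σ]∈ (only-nonemptyProper i≢e))
        (defends-from-t Uₜ _ i refl refl)
    steps-Uₜ i {suc _} n<L | no i≢e | false =
      backStep (swapC (only i) i≢e (only-o i)) (U[σ]∈ (only-nonemptyProper i≢e))
        (defends-up Uₜ _ i (s≤s z≤n) n<L (agree-≡ (oddIn-Uₜ-o i≢e) odd-n)
                    (cong flip (byRole-o i (only i))))

    steps-U[σ] : ∀ σ → ∀ i {n} → n < L i → Step U[ σ ] i n
    steps-U[σ] σ i {n} n<L with i Fin.≟ e | odd n in odd-n
    ... | yes refl | true with ℕ.m≤n⇒m<n∨m≡n n<L
    ...   | inj₁ 1+n<L = forthStep (swapB σ) Uₜ∈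
              (defends-down U[ σ ] _ e 1+n<L (agree-≡ (byKind-e σ) (cong not odd-n)) (byKind-e σ))
    ...   | inj₂ 1+n≡L = forthStep (swapB σ) Uₜ∈ (defends-from-s U[ σ ] _ e 1+n≡L refl refl)
    steps-U[σ] σ i {zero} n<L | yes refl | false =
      forthStep (swapA σ) Uₛ∈ (defends-from-t U[ σ ] _ e refl refl)
    steps-U[σ] σ i {suc _} n<L | yes refl | false = forthStep (swapA σ) Uₛ∈
      (defends-up U[ σ ] _ e (s≤s z≤n) n<L (agree-≡ (byKind-e σ) odd-n) (byKind-e σ))
    steps-U[σ] σ i {n} n<L | no i≢e | _ with σ i in σi
    steps-U[σ] σ i {n} n<L | no i≢e | true | true = forthStep (swapB σ) Uₜ∈
      (defends-up U[ σ ] _ i (odd⇒0< odd-n) n<L (agree-≡ (oddIn-U[σ] σ i≢e σi) odd-n)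
                  (byKind-σ σ i≢e σi))
    steps-U[σ] σ i {n} n<L | no i≢e | false | true with ℕ.m≤n⇒m<n∨m≡n n<L
    ... | inj₁ 1+n<L = forthStep (swapC σ i≢e σi) Uₜ∈
            (defends-down U[ σ ] _ i 1+n<L (agree-≡ (oddIn-U[σ] σ i≢e σi) (cong not odd-n))
                          (byRole-o i σ))
    ... | inj₂ 1+n≡L = forthStep (swapC σ i≢e σi) Uₜ∈ (defends-from-s U[ σ ] _ i 1+n≡L refl refl)
    steps-U[σ] σ i {n} n<L | no i≢e | true | false = forthStep (swapA σ) Uₛ∈
      (defends-down U[ σ ] _ i (1+n<L-o i≢e n<L odd-n)
                    (agree-≡ (oddIn-U[σ] σ i≢e σi) (cong not odd-n)) (byKind-σ σ i≢e σi))
    steps-U[σ] σ i {zero} n<L | no i≢e | false | false = forthStep (swapD σ i≢e σi) Uₛ∈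
      (defends-from-t U[ σ ] _ i refl refl)
    steps-U[σ] σ i {suc _} n<L | no i≢e | false | false = forthStep (swapD σ i≢e σi) Uₛ∈
      (defends-up U[ σ ] _ i (s≤s z≤n) n<L (agree-≡ (oddIn-U[σ] σ i≢e σi) odd-n) (byRole-o i σ))

    steps : ∀ {c} → InFamily c → ∀ i {n} → n < L i → Step c i n
    steps Uₛ∈ = steps-Uₛ
    steps Uₜ∈ = steps-Uₜ
    steps (U[σ]∈ {σ} _) = steps-U[σ] σ

    family-cover : ∀ {c} → InFamily c → IsVertexCover G (members c)
    family-cover {c} c∈ v w vw with edge-position v w vw
    ... | i , n , n<L , at with defends-edge c (Step.forth st) n<L at (Step.defends st)
      where
      st : Step c i n
      st = steps c∈ i n<L
    ...   | inj₁ (v∈ , _) = inj₁ v∈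
    ...   | inj₂ (w∈ , _) = inj₂ w∈

    family-size : ∀ {c} → InFamily c → ∣ members c ∣ ≡ ∣ members Uₛ ∣
    family-size Uₛ∈ = refl
    family-size Uₜ∈ =
      trans (sym (swap-∣∣≡ (swapB (only o₀)))) (family-size (U[σ]∈ (only-nonemptyProper o₀≢e)))
    family-size (U[σ]∈ {σ} _) = swap-∣∣≡ (swapA σ)

    module _ {C} (cover : IsVertexCover G C) where

      neighbour-of-t : ∀ i → t ∉ C → vertexAt i 1 ∈ C
      neighbour-of-t i t∉C =
        cover-neighbour cover (subst (E (vertexAt i 1)) (vertexAt-0 i) (E-sym (vertexAt-adj i (L≥1 i)))) t∉C

      -- Trade each vertex of U_s one step toward t, and s onto path o₀.
      ∣Uₛ∣≤∣C∣-without-t : t ∉ C → ∣ members Uₛ ∣ ≤ ∣ C ∣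
      ∣Uₛ∣≤∣C∣-without-t t∉C = cover-exchange Uₛ g g′ cover escapes
        where
        g g′ : Move
        g = move (λ _ → towardT) (just o₀) nothing
        g′ = move (λ _ → towardS) nothing nothing
        escapes : ∀ i {n} → n ≤ L i → occupied Uₛ i n ≡ true → vertexAt i n ∈ C ⊎ Escapes Uₛ g g′ i n
        escapes i n≤L occ with positionOn i n≤L
        ... | atT = contradiction occ λ ()
        ... | atS with L≡1⊎2≤L o₀
        ...   | inj₁ L≡1 = inj₁ (subst (_∈ C) (trans (cong (vertexAt o₀) (sym L≡1)) (trans (vertexAt-L o₀)
                                                                                    (sym (vertexAt-L i))))
                                       (neighbour-of-t o₀ t∉C))
        ...   | inj₂ 2≤L = inj₂ (subst (λ a → uncurry (occupied Uₛ) a ≡ false × uncurry (moveAt g′) a ≈ₚ (i , L i))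
                                       (sym (moveAt-s g i)) (escapes-s 2≤L))
          where
          escapes-s : 2 ≤ L o₀ →
                      occupied Uₛ o₀ (pred (L o₀)) ≡ false × uncurry (moveAt g′) (o₀ , pred (L o₀)) ≈ₚ (i , L i)
          escapes-s 2≤L rewrite occupied-interior Uₛ o₀ (0<pred 2≤L) (pred< 2≤L)
                              | moveAt-interior g′ o₀ (0<pred 2≤L) (pred< 2≤L) =
            odd-pred-o o₀≢e , inj₂ (inj₁ (ℕ.suc-pred (L o₀) ⦃ ℕ.>-nonZero (L≥1 o₀) ⦄ , refl))
        escapes i n≤L occ | interior {suc zero} _ _ = inj₁ (neighbour-of-t i t∉C)
        escapes i n≤L occ | interior {suc (suc n)} _ n<L = inj₂ (escapes-down Uₛ g g′ i n<L occ refl refl)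

      -- Trade each vertex of U_t one step toward s.
      ∣Uₜ∣≤∣C∣-without-s : t ∈ C → s ∉ C → ∣ members Uₜ ∣ ≤ ∣ C ∣
      ∣Uₜ∣≤∣C∣-without-s t∈C s∉C = cover-exchange Uₜ g g′ cover escapes
        where
        g g′ : Move
        g = move (λ _ → towardS) nothing nothing
        g′ = move (λ _ → towardT) nothing nothing
        escapes : ∀ i {n} → n ≤ L i → occupied Uₜ i n ≡ true → vertexAt i n ∈ C ⊎ Escapes Uₜ g g′ i n
        escapes i n≤L occ with positionOn i n≤L
        ... | atT = inj₁ (subst (_∈ C) (sym (vertexAt-0 i)) t∈C)
        ... | atS = contradiction (trans (sym (occupied-s Uₜ i)) occ) λ ()
        ... | interior {n} 0<n n<L with ℕ.m≤n⇒m<n∨m≡n n<L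
        ...   | inj₁ 1+n<L = inj₂ (escapes-up Uₜ _ _ i 0<n 1+n<L occ refl refl)
        ...   | inj₂ 1+n≡L = inj₁ (cover-neighbour cover (subst (E (vertexAt i n))
                                                               (trans (cong (vertexAt i) 1+n≡L) (vertexAt-L i))
                                                               (vertexAt-adj i n<L))
                                                        s∉C)

      -- Trade each interior vertex of U_S one step along its path, toward s except on the t-paths.
      ∣U[σ]∣≤∣C∣-with-s-t : ∀ σ → t ∈ C → s ∈ C → ∣ members U[ σ ] ∣ ≤ ∣ C ∣
      ∣U[σ]∣≤∣C∣-with-s-t σ t∈C s∈C = cover-exchange U[ σ ] g g′ cover escapes
        where
        d : Fin k → Dir
        d = byKind towardS towardS towardT σ
        g g′ : Move
        g = move d nothing nothing
        g′ = move (flip ∘ d) nothing nothing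
        escapes : ∀ i {n} → n ≤ L i → occupied U[ σ ] i n ≡ true → vertexAt i n ∈ C ⊎ Escapes U[ σ ] g g′ i n
        escapes i n≤L occ with positionOn i n≤L
        ... | atT = inj₁ (subst (_∈ C) (sym (vertexAt-0 i)) t∈C)
        ... | atS = inj₁ (subst (_∈ C) (sym (vertexAt-L i)) s∈C)
        ... | interior {n} 0<n n<L with i Fin.≟ e
        ...   | yes refl =
          inj₂ (escapes-up U[ σ ] g g′ e 0<n (1+n<L-e n<L odd-n) occ (byKind-e σ) (cong flip (byKind-e σ)))
          where
          odd-n : odd n ≡ false
          odd-n = trans (sym (occupied-interior⇒parity _ e 0<n n<L occ)) (byKind-e σ)
        ...   | no i≢e
          with σ i in σi | trans (sym (occupied-interior⇒parity _ i 0<n n<L occ)) (oddIn-U[σ] σ i≢e refl)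
        ...     | true | odd-n =
          inj₂ (escapes-up U[ σ ] g g′ i 0<n (1+n<L-o i≢e n<L odd-n) occ (byKind-σ σ i≢e σi)
                           (cong flip (byKind-σ σ i≢e σi)))
        escapes i n≤L occ | interior {suc (suc n)} 0<n n<L | no i≢e | false | odd-n =
          inj₂ (escapes-down U[ σ ] g g′ i n<L occ (byKind-σ σ i≢e σi) (cong flip (byKind-σ σ i≢e σi)))
        escapes i n≤L occ | interior {suc zero} 0<n n<L | no i≢e | false | ()

      ∣Uₛ∣≤∣C∣ : ∣ members Uₛ ∣ ≤ ∣ C ∣
      ∣Uₛ∣≤∣C∣ with t ∈? C | s ∈? C
      ... | no t∉C | _ = ∣Uₛ∣≤∣C∣-without-t t∉C
      ... | yes t∈C | no s∉C = subst (_≤ ∣ C ∣) (family-size Uₜ∈) (∣Uₜ∣≤∣C∣-without-s t∈C s∉C)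
      ... | yes t∈C | yes s∈C = subst (_≤ ∣ C ∣) (family-size (U[σ]∈ (only-nonemptyProper o₀≢e)))
                                      (∣U[σ]∣≤∣C∣-with-s-t (only o₀) t∈C s∈C)

    family-defense : ∀ U → 𝒰fam M e U → ∀ v w → E v w →
                     ∃[ φ ] (IsDefense G U v w φ × ∃[ W ] (𝒰fam M e W × IsImage G φ U W))
    family-defense U U∈ v w vw with 𝒰-family U∈ | edge-position v w vw
    ... | c , c∈ , refl | i , n , n<L , at =
      let open Step (steps c∈ i n<L)
          (defense , image) = reversible-defense reversible reversible⁻¹ n<L at defends
      in moveVertex forth , defense , members target , family-𝒰 inFamily , image

    family-class : IsEVCClass G (𝒰fam M e) ∣ members Uₛ ∣
    family-class =
      (members Uₛ , family-𝒰 Uₛ∈) ,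
      (λ U U∈ → let (c , c∈ , U≡c) = 𝒰-family U∈ in
                subst (λ V → IsVertexCover G V × ∣ V ∣ ≡ ∣ members Uₛ ∣) (sym U≡c)
                      (family-cover c∈ , family-size c∈)) ,
      family-defense

theorem15 : (G : Graph) (k : ℕ) (M : Melon G k) → 3 ≤ k →
    (e : Fin k) → Even (Melon.L M e) → (∀ i → i ≢ e → Odd (Melon.L M i)) →
    ∃[ n ] (IsVCNumber G n × IsEVCNumber G n)
      × IsMinimumEVCClass G (𝒰fam M e)
theorem15 G k M 3≤k e even-e odd-o = ∣ members Uₛ ∣ , vc∧evc , ∣ members Uₛ ∣ , family-class , proj₂ vc∧evc
  where
  open Family M e even-e odd-o
  open WithThreePaths 3≤k
  open Configurations M using (members)
  vc∧evc : IsVCNumber G ∣ members Uₛ ∣ × IsEVCNumber G ∣ members Uₛ ∣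
  vc∧evc = evc-class-at-cover-bound G family-class (λ _ → ∣Uₛ∣≤∣C∣)
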